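{- Let $n\ge4$ and let $\tilde{\mathbf{B}}_n$ be the graph on vertices $0,\dots,n$ with simple edges $1-2$, $0-2$, $2-3,\dots,(n-2)-(n-1)$ and a double edge from the longer vertex $n-1$ to the shorter vertex $n$. Then $\#\mathrm{Cl}(\tilde{\mathbf{B}}_n)=k+4$ if $n=2k+1$ and $k+5$ if $n=2k$. Let $\ell_0$ be the zero labeling, $\ell_1$ the labeling with $b_n=1$ only, $\ell_2$ the labeling with $b_0=b_1=1$ only, and $\ell_3$ the labeling with $b_0=b_1=b_n=1$ only. For $n=2k+1$, a set of minimal representatives of the classes is $\ell_0,\ell_1,\ell_2,\ell_3$ together with, for $i=1,\dots,k$, the labeling with $b_0=b_1=b_n=0$ and ones exactly at vertices $2,4,\dots,2i$. For $n=2k$, a set of minimal representatives is $\ell_0,\ell_1,\ell_2,\ell_3$, the labelings with $b_0=b_1=b_n=0$ and ones exactly at $2,4,\dots,2i$ for $i=1,\dots,k-1$, and the two labelings with $b_n=0$, exactly one of $b_0,b_1$ equal to $1$, and ones on the vertices $2,\dots,n-1$ exactly at $3,5,\dots,n-1$.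
   Context: Generalized Reeder's puzzle: a labeling assigns $b_j\in\mathbb{Z}/2\mathbb{Z}$ to each vertex $j$. Double edges are directed from a longer to a shorter vertex. The move $T_i$ replaces $b_i$ by $b_i+\sum_k b_k \pmod 2$, where $k$ runs over neighbors of $i$ excluding any neighbor that is the shorter endpoint of a double edge at $i$; other labels are unchanged. Equivalence is generated by moves; $\mathrm{Cl}(D)$ is the set of classes. A minimal representative of a class is a labeling in the class with the minimal number of $1$'s. -}

module Defs where

open import Data.Bool using (Bool; true; false; _∧_; _∨_; not; _xor_; if_then_else_)
open import Data.Nat using (ℕ; zero; suc; _+_; _*_; _∸_; _≤_; _≡ᵇ_; _≤ᵇ_; _<ᵇ_)
open import Data.Nat.Base using (_%_)
open import Data.Fin using (Fin; toℕ; _≟_)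
open import Data.Vec using (Vec; lookup; tabulate; _[_]≔_)
open import Data.Product using (Σ; ∃; ∃-syntax; _×_; _,_)
open import Relation.Nullary using (does)
open import Relation.Binary.PropositionalEquality using (_≡_)
open import Relation.Binary.Construct.Closure.Equivalence using (EqClosure)

-- A diagram: `edge i j` says i and j are joined (by a simple or a double
-- edge; should be symmetric), `double i j` says there is a double edge
-- directed from the longer vertex i to the shorter vertex j.
record Diagram (m : ℕ) : Set where
  field
    edge   : Fin m → Fin m → Bool
    double : Fin m → Fin m → Bool
open Diagram public

-- A labeling: b_j ∈ ℤ/2 (encoded as Bool, xor = addition) for each vertex j.
Labeling : ℕ → Set
Labeling m = Vec Bool m

xorSum : {m : ℕ} → (Fin m → Bool) → Bool
xorSum {zero}  f = false
xorSum {suc m} f = f Fin.zero xor xorSum (λ k → f (Fin.suc k))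

-- The move T_i: b_i ↦ b_i + Σ_k b_k, k over the neighbours of i except
-- a neighbour that is the shorter endpoint of a double edge at i.
move : {m : ℕ} → Diagram m → Fin m → Labeling m → Labeling m
move D i b = b [ i ]≔ (lookup b i xor
  xorSum (λ k → edge D i k ∧ not (double D i k) ∧ lookup b k))

Step : {m : ℕ} → Diagram m → Labeling m → Labeling m → Set
Step D x y = ∃[ i ] (y ≡ move D i x)

_∼⟨_⟩_ : {m : ℕ} → Labeling m → Diagram m → Labeling m → Set
x ∼⟨ D ⟩ y = EqClosure (Step D) x y

ones : {m : ℕ} → Labeling m → ℕ
ones Vec.[] = 0
ones (true Vec.∷ v) = suc (ones v)
ones (false Vec.∷ v) = ones v

-- #Cl(D) = c : some family Fin c → labelings meets every class exactly once,
-- i.e. induces a bijection Fin c ≃ Cl(D).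
NumClasses : {m : ℕ} → Diagram m → ℕ → Set
NumClasses {m} D c =
  Σ (Fin c → Labeling m) λ f →
    (∀ i j → f i ∼⟨ D ⟩ f j → i ≡ j) × (∀ x → ∃[ i ] (x ∼⟨ D ⟩ f i))

MinimalRepresentatives : {m c : ℕ} → Diagram m → (Fin c → Labeling m) → Set
MinimalRepresentatives {m} D f =
  (∀ i j → f i ∼⟨ D ⟩ f j → i ≡ j) ×
  (∀ x → ∃[ i ] (x ∼⟨ D ⟩ f i)) ×
  (∀ i (x : Labeling m) → x ∼⟨ D ⟩ f i → ones (f i) ≤ ones x)

-- oriented adjacency a < b
adjB : ℕ → ℕ → ℕ → Bool
adjB n a b =
  ((a ≡ᵇ 1) ∧ (b ≡ᵇ 2)) ∨ ((a ≡ᵇ 0) ∧ (b ≡ᵇ 2)) ∨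
  ((2 ≤ᵇ a) ∧ (b ≡ᵇ suc a) ∧ (b ≤ᵇ n ∸ 1)) ∨
  ((a ≡ᵇ n ∸ 1) ∧ (b ≡ᵇ n))

Btilde : (n : ℕ) → Diagram (suc n)
Btilde n = record
  { edge   = λ i j → adjB n (toℕ i) (toℕ j) ∨ adjB n (toℕ j) (toℕ i)
  ; double = λ i j → (toℕ i ≡ᵇ n ∸ 1) ∧ (toℕ j ≡ᵇ n)
  }

lab : (n : ℕ) → (ℕ → Bool) → Labeling (suc n)
lab n P = tabulate (λ i → P (toℕ i))

isEven : ℕ → Bool
isEven v = (v % 2) ≡ᵇ 0

ℓ₀ ℓ₁ ℓ₂ ℓ₃ : (n : ℕ) → Labeling (suc n)
ℓ₀ n = lab n (λ v → false)
ℓ₁ n = lab n (λ v → v ≡ᵇ n)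
ℓ₂ n = lab n (λ v → (v ≡ᵇ 0) ∨ (v ≡ᵇ 1))
ℓ₃ n = lab n (λ v → (v ≡ᵇ 0) ∨ (v ≡ᵇ 1) ∨ (v ≡ᵇ n))

-- ones exactly at 2,4,…,2i (b_0 = b_1 = b_n = 0, since 2i ≤ n-1 when used)
evensUpTo : (n i : ℕ) → Labeling (suc n)
evensUpTo n i = lab n (λ v → (2 ≤ᵇ v) ∧ (v ≤ᵇ 2 * i) ∧ isEven v)

oddsWith0 : (n : ℕ) → Labeling (suc n)
oddsWith0 n = lab n (λ v → (v ≡ᵇ 0) ∨ ((3 ≤ᵇ v) ∧ (v ≤ᵇ n ∸ 1) ∧ not (isEven v)))

oddsWith1 : (n : ℕ) → Labeling (suc n)
oddsWith1 n = lab n (λ v → (v ≡ᵇ 1) ∨ ((3 ≤ᵇ v) ∧ (v ≤ᵇ n ∸ 1) ∧ not (isEven v)))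

repsOdd : (n k : ℕ) → ℕ → Labeling (suc n)
repsOdd n k 0 = ℓ₀ n
repsOdd n k 1 = ℓ₁ n
repsOdd n k 2 = ℓ₂ n
repsOdd n k 3 = ℓ₃ n
repsOdd n k (suc (suc (suc j))) = evensUpTo n j

repsEven : (n k : ℕ) → ℕ → Labeling (suc n)
repsEven n k 0 = ℓ₀ n
repsEven n k 1 = ℓ₁ n
repsEven n k 2 = ℓ₂ n
repsEven n k 3 = ℓ₃ n
repsEven n k (suc (suc (suc j))) =
  if j <ᵇ k then evensUpTo n j
  else if j ≡ᵇ k then oddsWith0 n
  else oddsWith1 n

-- Fold b₀ + b₁ into one entry: G = (0, b₀ + b₁, b₂, …, b_{n-1}, 0), and let Δ = (G_m + G_{m+1})_{m<n}
-- be its n differences. For v < n the move T_v replaces G_p by G_{p-1} + G_p + G_{p+1}, p = max v 1,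
-- which transposes Δ_{p-1} and Δ_p; T_n fixes G and adds b_{n-1} = Δ_{n-1} to b_n. A labeling is
-- determined by (Δ, b₀, b_n), and adjacent transpositions realise every rearrangement of Δ, so the
-- class of a labeling is determined by its weight w = |Δ|, which is even since ΣΔ = G_0 + G_n = 0,
-- together with b₀ if w ∈ {0, n} and b_n if w = 0: T₀ changes b₀ by b₂ = Δ₀ + Δ₁ and T_n changes
-- b_n by Δ_{n-1}, and when Δ is neither constant (for b₀) nor zero (for b_n) it can first be
-- rearranged to make this change nonzero. Hence there are four classes of weight 0, one of each even
-- weight 0 < w < n and, when n is even, two of weight n. Minimality: the classes of weight 0 are
-- singletons, and G has at most as many ones as b, so w ≤ 2 · ones(b), while every other listed
-- representative has w / 2 ones.

module Submission where

open import Defs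
open import Algebra.Bundles using (CommutativeRing)
open import Data.Bool using (Bool; true; false; _∧_; _∨_; not; _xor_; if_then_else_; T)
open import Data.Bool.Properties
  renaming (_≟_ to _≟ᵇ_)
  using ( xor-assoc; xor-comm; xor-same; xor-identityʳ; xor-inverseʳ; not-involutive; not-distribʳ-xor
        ; ∧-assoc; ∧-zeroʳ; T-∧; T-∨; T-not-≡; xor-∧-commutativeRing)
open import Algebra.Properties.CommutativeSemigroup
  (CommutativeRing.+-commutativeSemigroup xor-∧-commutativeRing) using (interchange)
open import Data.Nat
  using (ℕ; zero; suc; _+_; _*_; _∸_; ⌊_/2⌋; _≤_; _<_; z≤n; s≤s; z<s; s<s; _≡ᵇ_; _≤ᵇ_; _<ᵇ_; _%_; _≟_)
open import Data.Nat.Properties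
open import Data.Nat.Tactic.RingSolver using (solve-∀)
open import Data.Nat.DivMod using ([m+n]%n≡m%n)
open import Data.Fin using (Fin; toℕ; fromℕ<; fromℕ)
open import Data.Fin.Properties using (toℕ<n; toℕ-fromℕ<; toℕ-fromℕ; toℕ-injective)
open import Data.Vec using (Vec; []; _∷_; lookup; tabulate; _[_]≔_)
open import Data.Product using (∃-syntax; _×_; _,_; proj₁; proj₂)
open import Data.Sum using (_⊎_; inj₁; inj₂)
open import Data.Empty using (⊥; ⊥-elim)
open import Data.Unit using (tt)
open import Function using (_∘_; Equivalence)
open import Relation.Nullary using (¬_; yes; no)
open import Relation.Binary.Definitions using (tri<; tri≈; tri>)
open import Relation.Binary.PropositionalEquality
open import Relation.Binary.Construct.Closure.Equivalence using (EqClosure; gmap; symmetric)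
open import Relation.Binary.Construct.Closure.ReflexiveTransitive using (ε; _◅_; _◅◅_)
open import Relation.Binary.Construct.Closure.Symmetric using (fwd; bwd)

open Equivalence using (to; from)

xor-cancelˡ : ∀ x y → x xor (x xor y) ≡ y
xor-cancelˡ x y = trans (sym (xor-assoc x x y)) (cong (_xor y) (xor-same x))

T-extensional : ∀ {x y} → (T x → T y) → (T y → T x) → x ≡ y
T-extensional {false} {false} _ _ = refl
T-extensional {false} {true}  _ g = ⊥-elim (g tt)
T-extensional {true}  {false} f _ = ⊥-elim (f tt)
T-extensional {true}  {true}  _ _ = refl

+-interchange : ∀ a b c d → (a + b) + (c + d) ≡ (a + c) + (b + d)
+-interchange = solve-∀

¬T⇒≡false : ∀ {b} → ¬ T b → b ≡ false
¬T⇒≡false {false} _ = refl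
¬T⇒≡false {true}  h = ⊥-elim (h tt)

T⇒≡true : ∀ {b} → T b → b ≡ true
T⇒≡true {true} _ = refl

∨-introˡ : ∀ x y → T x → T (x ∨ y)
∨-introˡ true y _ = tt

∨-introʳ : ∀ x {y} → T y → T (x ∨ y)
∨-introʳ true  _ = tt
∨-introʳ false t = t

∧-intro : ∀ {x y} → T x → T y → T (x ∧ y)
∧-intro {true} _ t = t

≡ᵇ-elim : ∀ (P : ℕ → Set) {a k} → P a → T (k ≡ᵇ a) → P k
≡ᵇ-elim P {a} {k} pa t = subst P (sym (≡ᵇ⇒≡ k a t)) pa

≡ᵇ-refl : ∀ m → (m ≡ᵇ m) ≡ true
≡ᵇ-refl m = T⇒≡true (≡⇒≡ᵇ m m refl)

≢⇒≡ᵇ≡false : ∀ {m k} → m ≢ k → (m ≡ᵇ k) ≡ false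
≢⇒≡ᵇ≡false {m} {k} m≢k = ¬T⇒≡false (m≢k ∘ ≡ᵇ⇒≡ m k)

xor-trueʳ : ∀ b → b xor true ≡ not b
xor-trueʳ false = refl
xor-trueʳ true  = refl

≢⇒not≡ : ∀ {a b} → a ≢ b → not a ≡ b
≢⇒not≡ {false} {false} a≢b = ⊥-elim (a≢b refl)
≢⇒not≡ {false} {true}  _   = refl
≢⇒not≡ {true}  {false} _   = refl
≢⇒not≡ {true}  {true}  a≢b = ⊥-elim (a≢b refl)

+-self-cancelˡ-≤ : ∀ a b → a + a ≤ b + b → a ≤ b
+-self-cancelˡ-≤ a b 2a≤2b = ≮⇒≥ (λ b<a → <⇒≱ (+-mono-< b<a b<a) 2a≤2b)

⌊n+n/2⌋≡n : ∀ j → ⌊ j + j /2⌋ ≡ j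
⌊n+n/2⌋≡n zero    = refl
⌊n+n/2⌋≡n (suc j) = trans (cong (⌊_/2⌋ ∘ suc) (+-suc j j)) (cong suc (⌊n+n/2⌋≡n j))

4+2a≡a+2+a+2 : ∀ a → 4 + 2 * a ≡ suc (suc a) + suc (suc a)
4+2a≡a+2+a+2 = solve-∀

2[a+2]≡4+2a : ∀ a → 2 * suc (suc a) ≡ 4 + 2 * a
2[a+2]≡4+2a = solve-∀

bit : Bool → ℕ
bit false = 0
bit true  = 1

count : ℕ → (ℕ → Bool) → ℕ
count zero    f = 0
count (suc N) f = bit (f 0) + count N (f ∘ suc)

parity : ℕ → (ℕ → Bool) → Bool
parity zero    f = false
parity (suc N) f = f 0 xor parity N (f ∘ suc)

count-cong : ∀ N {f g} → (∀ m → m < N → f m ≡ g m) → count N f ≡ count N g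
count-cong zero    h = refl
count-cong (suc N) h = cong₂ _+_ (cong bit (h 0 z<s)) (count-cong N (λ m → h (suc m) ∘ s<s))

parity-cong : ∀ N {f g} → (∀ m → m < N → f m ≡ g m) → parity N f ≡ parity N g
parity-cong zero    h = refl
parity-cong (suc N) h = cong₂ _xor_ (h 0 z<s) (parity-cong N (λ m → h (suc m) ∘ s<s))

xorSum≡parity : ∀ {N} (f : Fin N → Bool) (g : ℕ → Bool) → (∀ i → f i ≡ g (toℕ i)) →
                xorSum f ≡ parity N g
xorSum≡parity {zero}  f g h = refl
xorSum≡parity {suc N} f g h = cong₂ _xor_ (h Fin.zero) (xorSum≡parity (f ∘ Fin.suc) (g ∘ suc) (h ∘ Fin.suc))

count-snoc : ∀ N (f : ℕ → Bool) → count (suc N) f ≡ count N f + bit (f N)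
count-snoc zero    f = +-identityʳ (bit (f 0))
count-snoc (suc N) f = trans (cong (bit (f 0) +_) (count-snoc N (f ∘ suc))) (sym (+-assoc (bit (f 0)) _ _))

parity-snoc : ∀ N (f : ℕ → Bool) → parity (suc N) f ≡ parity N f xor f N
parity-snoc zero    f = xor-identityʳ (f 0)
parity-snoc (suc N) f = trans (cong (f 0 xor_) (parity-snoc N (f ∘ suc))) (sym (xor-assoc (f 0) _ _))

count-false : ∀ N {f} → (∀ m → f m ≡ false) → count N f ≡ 0
count-false zero    h = refl
count-false (suc N) h rewrite h 0 = count-false N (h ∘ suc)

count-true : ∀ N {f} → (∀ m → m < N → f m ≡ true) → count N f ≡ N
count-true zero    h = refl
count-true (suc N) h rewrite h 0 z<s = cong suc (count-true N (λ m → h (suc m) ∘ s<s))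

≤ᵇ-suc : ∀ u b → (suc u ≤ᵇ suc b) ≡ (u ≤ᵇ b)
≤ᵇ-suc zero    b = refl
≤ᵇ-suc (suc u) b = refl

count-≤ᵇ : ∀ N b → b < N → count N (_≤ᵇ b) ≡ suc b
count-≤ᵇ (suc N) zero    _         = cong suc (count-false N (λ _ → refl))
count-≤ᵇ (suc N) (suc b) (s≤s b<N) = cong suc (trans (count-cong N (λ m _ → ≤ᵇ-suc m b)) (count-≤ᵇ N b b<N))

count-mono : ∀ N {f g} → (∀ m → bit (f m) ≤ bit (g m)) → count N f ≤ count N g
count-mono zero    h = z≤n
count-mono (suc N) h = +-mono-≤ (h 0) (count-mono N (h ∘ suc))

bit-xor-≤ : ∀ a b → bit (a xor b) ≤ bit a + bit b
bit-xor-≤ false b     = ≤-refl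
bit-xor-≤ true  false = ≤-refl
bit-xor-≤ true  true  = z≤n

count-xor-≤ : ∀ N (f g : ℕ → Bool) → count N (λ m → f m xor g m) ≤ count N f + count N g
count-xor-≤ zero    f g = z≤n
count-xor-≤ (suc N) f g = begin
  bit (f 0 xor g 0) + count N (λ m → f (suc m) xor g (suc m))
    ≤⟨ +-mono-≤ (bit-xor-≤ (f 0) (g 0)) (count-xor-≤ N (f ∘ suc) (g ∘ suc)) ⟩
  (bit (f 0) + bit (g 0)) + (count N (f ∘ suc) + count N (g ∘ suc))
    ≡⟨ +-interchange (bit (f 0)) (bit (g 0)) _ _ ⟩
  (bit (f 0) + count N (f ∘ suc)) + (bit (g 0) + count N (g ∘ suc)) ∎
  where open ≤-Reasoning

count≡double+parity : ∀ N (f : ℕ → Bool) → ∃[ h ] count N f ≡ h + h + bit (parity N f)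
count≡double+parity zero    f = 0 , refl
count≡double+parity (suc N) f with count≡double+parity N (f ∘ suc)
... | h , e with f 0 | parity N (f ∘ suc)
...   | false | _     = h , e
...   | true  | false = h , trans (cong suc e) (carry₀ h)
  where
  carry₀ : ∀ h → suc (h + h + 0) ≡ h + h + 1
  carry₀ = solve-∀
...   | true  | true  = suc h , trans (cong suc e) (carry₁ h)
  where
  carry₁ : ∀ h → suc (h + h + 1) ≡ suc h + suc h + 0
  carry₁ = solve-∀

parity-xor : ∀ N (f g : ℕ → Bool) → parity N (λ m → f m xor g m) ≡ parity N f xor parity N g
parity-xor zero    f g = refl
parity-xor (suc N) f g =
  trans (cong ((f 0 xor g 0) xor_) (parity-xor N (f ∘ suc) (g ∘ suc))) (interchange (f 0) (g 0) _ _)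

parity-false : ∀ N → parity N (λ _ → false) ≡ false
parity-false zero    = refl
parity-false (suc N) = parity-false N

parity-at : ∀ N a (X : ℕ → Bool) → a < N → parity N (λ k → (k ≡ᵇ a) ∧ X k) ≡ X a
parity-at (suc N) zero    X _         = trans (cong (X 0 xor_) (parity-false N)) (xor-identityʳ (X 0))
parity-at (suc N) (suc a) X (s≤s a<N) = parity-at N a (X ∘ suc) a<N

∨-∧-disjoint : ∀ a b x → (T a → T b → ⊥) → (a ∨ b) ∧ x ≡ (a ∧ x) xor (b ∧ x)
∨-∧-disjoint true  true  x disj = ⊥-elim (disj tt tt)
∨-∧-disjoint true  false x disj = sym (xor-identityʳ x)
∨-∧-disjoint false b     x disj = refl

parity-∨ : ∀ N (p q X : ℕ → Bool) → (∀ k → T (p k) → T (q k) → ⊥) →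
           parity N (λ k → (p k ∨ q k) ∧ X k) ≡ parity N (λ k → p k ∧ X k) xor parity N (λ k → q k ∧ X k)
parity-∨ N p q X disj =
  trans (parity-cong N (λ k _ → ∨-∧-disjoint (p k) (q k) (X k) (disj k)))
        (parity-xor N (λ k → p k ∧ X k) (λ k → q k ∧ X k))

parity-at₂ : ∀ N a b (X : ℕ → Bool) → a ≢ b → a < N → b < N →
             parity N (λ k → ((k ≡ᵇ a) ∨ (k ≡ᵇ b)) ∧ X k) ≡ X a xor X b
parity-at₂ N a b X a≢b a<N b<N =
  trans (parity-∨ N (_≡ᵇ a) (_≡ᵇ b) X (λ k p q → a≢b (trans (sym (≡ᵇ⇒≡ k a p)) (≡ᵇ⇒≡ k b q))))
        (cong₂ _xor_ (parity-at N a X a<N) (parity-at N b X b<N))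

differences : (ℕ → Bool) → ℕ → Bool
differences g m = g m xor g (suc m)

telescope : ∀ g → g 0 ≡ false → ∀ m → g m ≡ parity m (differences g)
telescope g g0 zero    = g0
telescope g g0 (suc m) = begin
  g (suc m)                                   ≡⟨ xor-cancelˡ (g m) (g (suc m)) ⟨
  g m xor differences g m                     ≡⟨ cong (_xor differences g m) (telescope g g0 m) ⟩
  parity m (differences g) xor differences g m ≡⟨ parity-snoc m (differences g) ⟨
  parity (suc m) (differences g)              ∎
  where open ≡-Reasoning

isEven-+2 : ∀ u → isEven (suc (suc u)) ≡ isEven u
isEven-+2 u = cong (_≡ᵇ 0) (trans (cong (_% 2) (+-comm 2 u)) ([m+n]%n≡m%n u 2))

isEven-suc : ∀ u → isEven (suc u) ≡ not (isEven u)
isEven-suc zero          = refl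
isEven-suc (suc zero)    = refl
isEven-suc (suc (suc u)) = trans (isEven-+2 (suc u)) (trans (isEven-suc u) (cong not (sym (isEven-+2 u))))

≤ᵇ-+2 : ∀ u b → (suc (suc u) ≤ᵇ suc (suc b)) ≡ (u ≤ᵇ b)
≤ᵇ-+2 u b = trans (≤ᵇ-suc (suc u) (suc b)) (≤ᵇ-suc u b)

isEven-double : ∀ a → isEven (2 * a) ≡ true
isEven-double zero    = refl
isEven-double (suc a) = trans (cong isEven (*-suc 2 a)) (trans (isEven-+2 (2 * a)) (isEven-double a))

evenUpTo : ℕ → ℕ → Bool
evenUpTo a u = (u ≤ᵇ 2 * a) ∧ isEven u

evenUpTo-+2 : ∀ a u → evenUpTo (suc a) (suc (suc u)) ≡ evenUpTo a u
evenUpTo-+2 a u = cong₂ _∧_ (trans (cong (suc (suc u) ≤ᵇ_) (*-suc 2 a)) (≤ᵇ-+2 u (2 * a))) (isEven-+2 u)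

differences-evenUpTo : ∀ a u → differences (evenUpTo a) u ≡ (u ≤ᵇ 2 * a)
differences-evenUpTo zero    zero          = refl
differences-evenUpTo zero    (suc u)       = refl
differences-evenUpTo (suc a) zero          = refl
differences-evenUpTo (suc a) (suc zero)    = evenUpTo-+2 a 0
differences-evenUpTo (suc a) (suc (suc u)) = begin
  differences (evenUpTo (suc a)) (suc (suc u))  ≡⟨ cong₂ _xor_ (evenUpTo-+2 a u) (evenUpTo-+2 a (suc u)) ⟩
  differences (evenUpTo a) u                    ≡⟨ differences-evenUpTo a u ⟩
  u ≤ᵇ 2 * a                                    ≡⟨ ≤ᵇ-+2 u (2 * a) ⟨
  suc (suc u) ≤ᵇ suc (suc (2 * a))              ≡⟨ cong (suc (suc u) ≤ᵇ_) (*-suc 2 a) ⟨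
  suc (suc u) ≤ᵇ 2 * suc a                      ∎
  where open ≡-Reasoning

count-evenUpTo : ∀ N a → 2 * a < N → count N (evenUpTo a) ≡ suc a
count-evenUpTo (suc N)       zero    _      = cong suc (count-false N (λ _ → refl))
count-evenUpTo (suc (suc N)) (suc a) 2a+2<N =
  cong suc (trans (count-cong N (λ m _ → evenUpTo-+2 a m))
                  (count-evenUpTo N a (≤-pred (≤-pred (subst (_< suc (suc N)) (*-suc 2 a) 2a+2<N)))))
count-evenUpTo (suc zero)    (suc a) 2a+2<1 = ⊥-elim (<⇒≱ 2a+2<1 (subst (1 ≤_) (sym (*-suc 2 a)) (s≤s z≤n)))

-- Boolean vectors and sequences: reading, transpositions and sorting

get : ∀ {N} → Vec Bool N → ℕ → Bool
get []      m       = false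
get (b ∷ v) zero    = b
get (b ∷ v) (suc m) = get v m

get-lookup : ∀ {N} (v : Vec Bool N) i → lookup v i ≡ get v (toℕ i)
get-lookup (b ∷ v) Fin.zero    = refl
get-lookup (b ∷ v) (Fin.suc i) = get-lookup v i

get-[]≔ : ∀ {N} (v : Vec Bool N) i c m → get (v [ i ]≔ c) m ≡ (if m ≡ᵇ toℕ i then c else get v m)
get-[]≔ (b ∷ v) Fin.zero    c zero    = refl
get-[]≔ (b ∷ v) Fin.zero    c (suc m) = refl
get-[]≔ (b ∷ v) (Fin.suc i) c zero    = refl
get-[]≔ (b ∷ v) (Fin.suc i) c (suc m) = get-[]≔ v i c m

get-tabulate : ∀ {N} (P : ℕ → Bool) m → m < N → get (tabulate {n = N} (P ∘ toℕ)) m ≡ P m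
get-tabulate {suc N} P zero    _         = refl
get-tabulate {suc N} P (suc m) (s≤s m<N) = get-tabulate {N} (P ∘ suc) m m<N

get-extensional : ∀ {N} (u v : Vec Bool N) → (∀ m → m < N → get u m ≡ get v m) → u ≡ v
get-extensional []      []      h = refl
get-extensional (a ∷ u) (b ∷ v) h = cong₂ _∷_ (h 0 z<s) (get-extensional u v (λ m → h (suc m) ∘ s<s))

ones≡count : ∀ {N} (v : Vec Bool N) → ones v ≡ count N (get v)
ones≡count []          = refl
ones≡count (true ∷ v)  = cong suc (ones≡count v)
ones≡count (false ∷ v) = ones≡count v

ones≤length : ∀ {N} (v : Vec Bool N) → ones v ≤ N
ones≤length []          = z≤n
ones≤length (true ∷ v)  = s≤s (ones≤length v)
ones≤length (false ∷ v) = m≤n⇒m≤1+n (ones≤length v)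

ones≡0⇒get≡false : ∀ {N} (v : Vec Bool N) → ones v ≡ 0 → ∀ m → get v m ≡ false
ones≡0⇒get≡false []          _ m       = refl
ones≡0⇒get≡false (false ∷ v) _ zero    = refl
ones≡0⇒get≡false (false ∷ v) e (suc m) = ones≡0⇒get≡false v e m

ones≡length⇒get≡true : ∀ {N} (v : Vec Bool N) → ones v ≡ N → ∀ m → m < N → get v m ≡ true
ones≡length⇒get≡true (true ∷ v)  e zero    _         = refl
ones≡length⇒get≡true (true ∷ v)  e (suc m) (s≤s m<N) = ones≡length⇒get≡true v (suc-injective e) m m<N
ones≡length⇒get≡true {suc N} (false ∷ v) e m _ = ⊥-elim (<-irrefl refl (subst (_≤ N) e (ones≤length v)))

swapAt : ∀ {N} → ℕ → Vec Bool N → Vec Bool N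
swapAt zero    (a ∷ b ∷ v) = b ∷ a ∷ v
swapAt (suc k) (a ∷ v)     = a ∷ swapAt k v
swapAt _       v           = v

swapF : ℕ → (ℕ → Bool) → ℕ → Bool
swapF a f m = if m ≡ᵇ a then f (suc a) else if m ≡ᵇ suc a then f a else f m

get-swapAt : ∀ {N} a (u : Vec Bool N) m → suc a < N → get (swapAt a u) m ≡ swapF a (get u) m
get-swapAt zero    (x ∷ y ∷ w) zero          _         = refl
get-swapAt zero    (x ∷ y ∷ w) (suc zero)    _         = refl
get-swapAt zero    (x ∷ y ∷ w) (suc (suc m)) _         = refl
get-swapAt zero    (x ∷ [])    m             (s≤s ())
get-swapAt (suc a) (x ∷ w)     zero          _         = refl
get-swapAt (suc a) (x ∷ w)     (suc m)       (s≤s a<N) = get-swapAt a w m a<N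

swapF-cong : ∀ N a {f g : ℕ → Bool} m → (∀ j → j < N → f j ≡ g j) → m < N → suc a < N →
             swapF a f m ≡ swapF a g m
swapF-cong N a m f≗g m<N a+1<N with m ≡ᵇ a | m ≡ᵇ suc a
... | true  | _     = f≗g (suc a) a+1<N
... | false | true  = f≗g a (≤-trans (n≤1+n _) a+1<N)
... | false | false = f≗g m m<N

ones-swapAt : ∀ {N} a (u : Vec Bool N) → ones (swapAt a u) ≡ ones u
ones-swapAt zero    []                  = refl
ones-swapAt zero    (x ∷ [])            = refl
ones-swapAt zero    (true ∷ true ∷ v)   = refl
ones-swapAt zero    (true ∷ false ∷ v)  = refl
ones-swapAt zero    (false ∷ true ∷ v)  = refl
ones-swapAt zero    (false ∷ false ∷ v) = refl
ones-swapAt (suc k) []          = refl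
ones-swapAt (suc k) (true ∷ v)  = cong suc (ones-swapAt k v)
ones-swapAt (suc k) (false ∷ v) = ones-swapAt k v

swapAt-involutive : ∀ {N} a (u : Vec Bool N) → swapAt a (swapAt a u) ≡ u
swapAt-involutive zero    []          = refl
swapAt-involutive zero    (x ∷ [])    = refl
swapAt-involutive zero    (x ∷ y ∷ w) = refl
swapAt-involutive (suc a) []          = refl
swapAt-involutive (suc a) (x ∷ w)     = cong (x ∷_) (swapAt-involutive a w)

SwapStep : ∀ N → Vec Bool N → Vec Bool N → Set
SwapStep N u v = ∃[ a ] suc a < N × v ≡ swapAt a u

sorted : (N w : ℕ) → Vec Bool N
sorted zero    w       = []
sorted (suc N) zero    = false ∷ sorted N zero
sorted (suc N) (suc w) = true ∷ sorted N w

ones-sorted : ∀ N w → w ≤ N → ones (sorted N w) ≡ w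
ones-sorted zero    zero    _         = refl
ones-sorted (suc N) zero    _         = ones-sorted N zero z≤n
ones-sorted (suc N) (suc w) (s≤s w≤N) = cong suc (ones-sorted N w w≤N)

sorted-head : ∀ N w → 0 < w → get (sorted (suc N) w) 0 ≡ true
sorted-head N (suc w) _ = refl

trailing : (N w : ℕ) → Vec Bool N
trailing zero    w = []
trailing (suc N) w = (N <ᵇ w) ∷ trailing N w

ones-trailing : ∀ N w → w ≤ N → ones (trailing N w) ≡ w
ones-trailing zero    zero _   = refl
ones-trailing (suc N) w    w≤N with m≤n⇒m<n∨m≡n w≤N
... | inj₁ w<N rewrite ¬T⇒≡false (≤⇒≯ (≤-pred w<N) ∘ <ᵇ⇒< N w) = ones-trailing N w (≤-pred w<N)
... | inj₂ refl rewrite T⇒≡true (<⇒<ᵇ (≤-refl {suc N})) = cong suc (all-ones N (n≤1+n N))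
  where
  all-ones : ∀ N {w} → N ≤ w → ones (trailing N w) ≡ N
  all-ones zero    _   = refl
  all-ones (suc N) N<w rewrite T⇒≡true (<⇒<ᵇ N<w) = cong suc (all-ones N (≤-trans (n≤1+n N) N<w))

get-trailing-last : ∀ N w → 0 < w → get (trailing (suc N) w) N ≡ true
get-trailing-last zero    w w>0 = T⇒≡true (<⇒<ᵇ w>0)
get-trailing-last (suc N) w w>0 = get-trailing-last N w w>0

swaps-∷ : ∀ {N} b {u v : Vec Bool N} → EqClosure (SwapStep N) u v → EqClosure (SwapStep (suc N)) (b ∷ u) (b ∷ v)
swaps-∷ b = gmap (b ∷_) λ { (a , a<N , eq) → suc a , s<s a<N , cong (b ∷_) eq }

false∷sorted-swaps : ∀ N w → w ≤ N → EqClosure (SwapStep (suc N)) (false ∷ sorted N w) (sorted (suc N) w)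
false∷sorted-swaps N       zero    _         = ε
false∷sorted-swaps (suc N) (suc w) (s≤s w≤N) =
  fwd (0 , s<s z<s , refl) ◅ swaps-∷ true (false∷sorted-swaps N w w≤N)

sort-by-swaps : ∀ {N} (v : Vec Bool N) → EqClosure (SwapStep N) v (sorted N (ones v))
sort-by-swaps []          = ε
sort-by-swaps (true ∷ v)  = swaps-∷ true (sort-by-swaps v)
sort-by-swaps (false ∷ v) = swaps-∷ false (sort-by-swaps v) ◅◅ false∷sorted-swaps _ (ones v) (ones≤length v)

swaps-connect : ∀ {N} (u v : Vec Bool N) → ones u ≡ ones v → EqClosure (SwapStep N) u v
swaps-connect {N} u v e =
  sort-by-swaps u ◅◅ subst (λ w → EqClosure (SwapStep N) (sorted N w) v) (sym e) (symmetric _ (sort-by-swaps v))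

FlipAt : (ℕ → Bool) → (ℕ → Bool) → ℕ → Bool → Set
FlipAt X X′ v s = (∀ m → m ≢ v → X′ m ≡ X m) × X′ v ≡ X v xor s

differences-flip : ∀ {g g′} a → FlipAt g g′ (suc a) (g a xor g (suc (suc a))) →
                   ∀ m → differences g′ m ≡ swapF a (differences g) m
differences-flip {g} {g′} a (same , flipped) m with m ≟ a | m ≟ suc a
... | yes refl | _ rewrite ≡ᵇ-refl m | same m (<⇒≢ ≤-refl) | flipped =
  cancel (g m) (g (suc m)) (g (suc (suc m)))
  where
  cancel : ∀ x y z → x xor (y xor (x xor z)) ≡ y xor z
  cancel false y z = refl
  cancel true  y z = trans (not-distribʳ-xor y (not z)) (cong (y xor_) (not-involutive z))
... | no m≢a | yes refl rewrite ≢⇒≡ᵇ≡false m≢a | ≡ᵇ-refl m | flipped | same (suc m) (>⇒≢ ≤-refl) =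
  cancel (g a) (g m) (g (suc m))
  where
  cancel : ∀ x y z → (y xor (x xor z)) xor z ≡ x xor y
  cancel false false false = refl
  cancel false false true  = refl
  cancel false true  false = refl
  cancel false true  true  = refl
  cancel true  false false = refl
  cancel true  false true  = refl
  cancel true  true  false = refl
  cancel true  true  true  = refl
... | no m≢a | no m≢a+1 rewrite ≢⇒≡ᵇ≡false m≢a | ≢⇒≡ᵇ≡false m≢a+1 =
  cong₂ _xor_ (same m m≢a+1) (same (suc m) (m≢a ∘ suc-injective))

-- Equivalence classes on an arbitrary diagram

module _ {m : ℕ} (D : Diagram m) where

  move-∼ : ∀ x i → x ∼⟨ D ⟩ move D i x
  move-∼ x i = fwd (i , refl) ◅ ε

  ∼-invariant : ∀ {A : Set} (F : Labeling m → A) → (∀ x i → F (move D i x) ≡ F x) →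
                ∀ {x y} → x ∼⟨ D ⟩ y → F x ≡ F y
  ∼-invariant F inv ε                         = refl
  ∼-invariant F inv {x} (fwd (i , refl) ◅ xy) = trans (sym (inv x i)) (∼-invariant F inv xy)
  ∼-invariant F inv (bwd (i , refl) ◅ xy)     = trans (inv _ i) (∼-invariant F inv xy)

  classes-from-invariant : ∀ {c} (f : Fin c → Labeling m) (code : Labeling m → ℕ) →
    (∀ x i → code (move D i x) ≡ code x) → (∀ i → code (f i) ≡ toℕ i) →
    (∀ x → ∃[ i ] x ∼⟨ D ⟩ f i) → (∀ i x → x ∼⟨ D ⟩ f i → ones (f i) ≤ ones x) →
    NumClasses D c × MinimalRepresentatives D f
  classes-from-invariant f code inv code-f cover minimal = (f , distinct , cover) , distinct , cover , minimal
    where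
    distinct : ∀ i j → f i ∼⟨ D ⟩ f j → i ≡ j
    distinct i j fi∼fj = toℕ-injective (trans (sym (code-f i)) (trans (∼-invariant code inv fi∼fj) (code-f j)))

-- The diagram B̃ₙ; writing n = r + 4 makes n ∸ 1 and n ≡ᵇ 0 compute

module PuzzleB̃ (r : ℕ) where

  n′ n : ℕ
  n′ = suc (suc (suc r))
  n  = suc n′

  data Edge : ℕ → ℕ → Set where
    e₁₂         : Edge 1 2
    e₀₂         : Edge 0 2
    chain       : ∀ {a} → 2 ≤ a → suc a ≤ n′ → Edge a (suc a)
    double-edge : Edge n′ n

  edge-sound : ∀ a b → T (adjB n a b) → Edge a b
  edge-sound a b t with to T-∨ t
  ... | inj₁ t₁ with to T-∧ t₁
  ...   | p , q with ≡ᵇ⇒≡ a 1 p | ≡ᵇ⇒≡ b 2 q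
  ...     | refl | refl = e₁₂
  edge-sound a b t | inj₂ t₂ with to T-∨ t₂
  ... | inj₁ t₁ with to T-∧ t₁
  ...   | p , q with ≡ᵇ⇒≡ a 0 p | ≡ᵇ⇒≡ b 2 q
  ...     | refl | refl = e₀₂
  edge-sound a b t | inj₂ t₂ | inj₂ t₃ with to T-∨ t₃
  ... | inj₁ t₁ with to (T-∧ {2 ≤ᵇ a}) t₁
  ...   | p , q with to (T-∧ {b ≡ᵇ suc a}) q
  ...     | q₁ , q₂ with ≡ᵇ⇒≡ b (suc a) q₁
  ...       | refl = chain (≤ᵇ⇒≤ 2 a p) (≤ᵇ⇒≤ b n′ q₂)
  edge-sound a b t | inj₂ t₂ | inj₂ t₃ | inj₂ t₄ with to T-∧ t₄
  ... | p , q with ≡ᵇ⇒≡ a n′ p | ≡ᵇ⇒≡ b n q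
  ...   | refl | refl = double-edge

  edge-complete : ∀ {a b} → Edge a b → T (adjB n a b)
  edge-complete e₁₂                                   = tt
  edge-complete e₀₂                                   = tt
  edge-complete (chain {suc (suc a)} (s≤s (s≤s _)) q) = ∨-introˡ _ _ (∧-intro (≡⇒≡ᵇ a a refl) (≤⇒≤ᵇ q))
  edge-complete double-edge                           = ∨-introʳ _ (∧-intro (≡⇒≡ᵇ n′ n′ refl) (≡⇒≡ᵇ n n refl))

  edge-source< : ∀ {a b} → Edge a b → a < n
  edge-source< e₁₂         = s≤s (s≤s z≤n)
  edge-source< e₀₂         = s≤s z≤n
  edge-source< (chain _ q) = ≤-trans (n≤1+n _) (s≤s q)
  edge-source< double-edge = ≤-refl

  Adjacent : ℕ → ℕ → Set
  Adjacent v k = Edge v k ⊎ Edge k v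

  -- The summands of the move T_v: the neighbours of v other than n.
  counts : ℕ → ℕ → Bool
  counts v k = (adjB n v k ∨ adjB n k v) ∧ not ((v ≡ᵇ n′) ∧ (k ≡ᵇ n))

  counts-sound : ∀ v k → T (counts v k) → Adjacent v k × k < n
  counts-sound v k t with to (T-∧ {adjB n v k ∨ adjB n k v}) t
  ... | t₁ , t₂ with to (T-∨ {adjB n v k}) t₁
  ...   | inj₂ e = inj₂ (edge-sound k v e) , edge-source< (edge-sound k v e)
  ...   | inj₁ e with edge-sound v k e
  ...     | e₁₂         = inj₁ e₁₂ , s≤s (s≤s (s≤s z≤n))
  ...     | e₀₂         = inj₁ e₀₂ , s≤s (s≤s (s≤s z≤n))
  ...     | chain p q   = inj₁ (chain p q) , s≤s q
  ...     | double-edge = ⊥-elim (subst (λ b → T (not (b ∧ b))) (≡ᵇ-refl r) t₂)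

  counts-complete : ∀ {v k} → Adjacent v k → k < n → T (counts v k)
  counts-complete {v} {k} adj k<n = ∧-intro (adjacent adj) (from T-not-≡ not-to-n)
    where
    adjacent : Adjacent v k → T (adjB n v k ∨ adjB n k v)
    adjacent (inj₁ e) = ∨-introˡ _ _ (edge-complete e)
    adjacent (inj₂ e) = ∨-introʳ (adjB n v k) (edge-complete e)
    not-to-n : ((v ≡ᵇ n′) ∧ (k ≡ᵇ n)) ≡ false
    not-to-n = trans (cong ((v ≡ᵇ n′) ∧_) (≢⇒≡ᵇ≡false (<⇒≢ k<n))) (∧-zeroʳ _)

  counts-≡ : ∀ v (S : ℕ → Bool) → (∀ {k} → Adjacent v k → k < n → T (S k)) →
             (∀ {k} → T (S k) → Adjacent v k × k < n) → ∀ k → counts v k ≡ S k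
  counts-≡ v S sound complete k =
    T-extensional (λ t → let (adj , k<n) = counts-sound v k t in sound adj k<n)
                  (λ t → let (adj , k<n) = complete t in counts-complete adj k<n)

  counts-low : ∀ {v} → v ≤ 1 → ∀ k → counts v k ≡ (k ≡ᵇ 2)
  counts-low {v} v≤1 = counts-≡ v (_≡ᵇ 2) (sound v≤1) (complete v≤1)
    where
    sound : ∀ {v k} → v ≤ 1 → Adjacent v k → k < n → T (k ≡ᵇ 2)
    sound z≤n       (inj₁ e₀₂)               _ = tt
    sound (s≤s z≤n) (inj₁ e₁₂)               _ = tt
    sound z≤n       (inj₁ (chain () _))      _
    sound (s≤s z≤n) (inj₁ (chain (s≤s ()) _)) _
    sound (s≤s z≤n) (inj₂ (chain () _))      _
    complete : ∀ {v k} → v ≤ 1 → T (k ≡ᵇ 2) → Adjacent v k × k < n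
    complete z≤n       = ≡ᵇ-elim (λ k → Adjacent 0 k × k < n) (inj₁ e₀₂ , s≤s (s≤s (s≤s z≤n)))
    complete (s≤s z≤n) = ≡ᵇ-elim (λ k → Adjacent 1 k × k < n) (inj₁ e₁₂ , s≤s (s≤s (s≤s z≤n)))

  counts-2 : ∀ k → counts 2 k ≡ ((k ≡ᵇ 0) ∨ (k ≡ᵇ 1) ∨ (k ≡ᵇ 3))
  counts-2 = counts-≡ 2 _ sound complete
    where
    sound : ∀ {k} → Adjacent 2 k → k < n → T ((k ≡ᵇ 0) ∨ (k ≡ᵇ 1) ∨ (k ≡ᵇ 3))
    sound (inj₁ (chain _ _))      _ = tt
    sound (inj₂ e₁₂)              _ = tt
    sound (inj₂ e₀₂)              _ = tt
    sound (inj₂ (chain (s≤s ()) _)) _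
    complete : ∀ {k} → T ((k ≡ᵇ 0) ∨ (k ≡ᵇ 1) ∨ (k ≡ᵇ 3)) → Adjacent 2 k × k < n
    complete {0} _ = inj₂ e₀₂ , s≤s z≤n
    complete {1} _ = inj₂ e₁₂ , s≤s (s≤s z≤n)
    complete {3} _ = inj₁ (chain ≤-refl (s≤s (s≤s (s≤s z≤n)))) , s≤s (s≤s (s≤s (s≤s z≤n)))
    complete {2} ()
    complete {suc (suc (suc (suc k)))} ()

  counts-mid : ∀ {u} → 2 ≤ u → suc (suc u) < n → ∀ k → counts (suc u) k ≡ ((k ≡ᵇ u) ∨ (k ≡ᵇ suc (suc u)))
  counts-mid {u} 2≤u u+2<n = counts-≡ (suc u) _ (sound 2≤u u+2<n) complete
    where
    sound : ∀ {u k} → 2 ≤ u → suc (suc u) < n → Adjacent (suc u) k → k < n → T ((k ≡ᵇ u) ∨ (k ≡ᵇ suc (suc u)))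
    sound {u} _           _   (inj₁ (chain _ _))   _ = ∨-introʳ (suc (suc u) ≡ᵇ u) (≡⇒≡ᵇ (suc u) (suc u) refl)
    sound {u} _           _   (inj₂ (chain _ _))   _ = ∨-introˡ (u ≡ᵇ u) _ (≡⇒≡ᵇ u u refl)
    sound     _           u+2<n (inj₁ double-edge) _ = ⊥-elim (1+n≰n u+2<n)
    sound     _           u+2<n (inj₂ double-edge) _ = ⊥-elim (1+n≰n (≤-trans (n≤1+n _) u+2<n))
    sound     (s≤s ())    _   (inj₂ e₁₂) _
    sound     (s≤s ())    _   (inj₂ e₀₂) _
    complete : ∀ {k} → T ((k ≡ᵇ u) ∨ (k ≡ᵇ suc (suc u))) → Adjacent (suc u) k × k < n
    complete {k} t with to (T-∨ {k ≡ᵇ u}) t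
    ... | inj₁ k≡u  = ≡ᵇ-elim (λ k → Adjacent (suc u) k × k < n)
                        (inj₂ (chain 2≤u (≤-pred (<⇒≤ u+2<n))) , ≤-trans (n≤1+n _) (<⇒≤ u+2<n)) k≡u
    ... | inj₂ k≡u+2 = ≡ᵇ-elim (λ k → Adjacent (suc u) k × k < n)
                        (inj₁ (chain (≤-trans 2≤u (n≤1+n u)) (≤-pred u+2<n)) , u+2<n) k≡u+2

  counts-n′ : ∀ k → counts n′ k ≡ (k ≡ᵇ suc (suc r))
  counts-n′ = counts-≡ n′ _ sound complete
    where
    sound : ∀ {k} → Adjacent n′ k → k < n → T (k ≡ᵇ suc (suc r))
    sound (inj₂ (chain _ _))   _   = ≡⇒≡ᵇ (suc (suc r)) (suc (suc r)) refl
    sound (inj₁ (chain _ q))   _   = ⊥-elim (1+n≰n q)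
    sound (inj₁ double-edge)   n<n = ⊥-elim (<-irrefl refl n<n)
    complete : ∀ {k} → T (k ≡ᵇ suc (suc r)) → Adjacent n′ k × k < n
    complete = ≡ᵇ-elim (λ k → Adjacent n′ k × k < n) (inj₂ (chain (s≤s (s≤s z≤n)) ≤-refl) , n≤1+n n′)

  counts-n : ∀ k → counts n k ≡ (k ≡ᵇ n′)
  counts-n = counts-≡ n _ sound complete
    where
    sound : ∀ {k} → Adjacent n k → k < n → T (k ≡ᵇ n′)
    sound (inj₂ double-edge) _ = ≡⇒≡ᵇ n′ n′ refl
    sound (inj₂ (chain _ q)) _ = ⊥-elim (1+n≰n q)
    sound (inj₁ (chain _ q)) _ = ⊥-elim (1+n≰n (≤-trans (n≤1+n _) q))
    complete : ∀ {k} → T (k ≡ᵇ n′) → Adjacent n k × k < n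
    complete = ≡ᵇ-elim (λ k → Adjacent n k × k < n) (inj₂ double-edge , ≤-refl)

  neighbourSum : ℕ → (ℕ → Bool) → Bool
  neighbourSum v X = parity (suc n) (λ k → counts v k ∧ X k)

  neighbourSum-cong : ∀ v X (S : ℕ → Bool) → (∀ k → counts v k ≡ S k) →
                      neighbourSum v X ≡ parity (suc n) (λ k → S k ∧ X k)
  neighbourSum-cong v X S h = parity-cong (suc n) (λ k _ → cong (_∧ X k) (h k))

  neighbourSum-low : ∀ {v} X → v ≤ 1 → neighbourSum v X ≡ X 2
  neighbourSum-low {v} X v≤1 =
    trans (neighbourSum-cong v X _ (counts-low v≤1)) (parity-at (suc n) 2 X (s≤s (s≤s (s≤s z≤n))))

  neighbourSum-2 : ∀ X → neighbourSum 2 X ≡ X 0 xor (X 1 xor X 3)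
  neighbourSum-2 X = begin
    neighbourSum 2 X
      ≡⟨ neighbourSum-cong 2 X _ counts-2 ⟩
    parity (suc n) (λ k → ((k ≡ᵇ 0) ∨ (k ≡ᵇ 1) ∨ (k ≡ᵇ 3)) ∧ X k)
      ≡⟨ parity-∨ (suc n) (_≡ᵇ 0) (λ k → (k ≡ᵇ 1) ∨ (k ≡ᵇ 3)) X disjoint ⟩
    parity (suc n) (λ k → (k ≡ᵇ 0) ∧ X k) xor parity (suc n) (λ k → ((k ≡ᵇ 1) ∨ (k ≡ᵇ 3)) ∧ X k)
      ≡⟨ cong₂ _xor_ (parity-at (suc n) 0 X z<s)
                     (parity-at₂ (suc n) 1 3 X (λ ()) (s≤s (s≤s z≤n)) (s≤s (s≤s (s≤s (s≤s z≤n))))) ⟩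
    X 0 xor (X 1 xor X 3) ∎
    where
    open ≡-Reasoning
    disjoint : ∀ k → T (k ≡ᵇ 0) → T ((k ≡ᵇ 1) ∨ (k ≡ᵇ 3)) → ⊥
    disjoint zero    _ ()
    disjoint (suc k) () _

  neighbourSum-mid : ∀ {u} X → 2 ≤ u → suc (suc u) < n → neighbourSum (suc u) X ≡ X u xor X (suc (suc u))
  neighbourSum-mid {u} X 2≤u u+2<n =
    trans (neighbourSum-cong (suc u) X _ (counts-mid 2≤u u+2<n))
          (parity-at₂ (suc n) u (suc (suc u)) X (λ ()) (≤-trans (n≤1+n _) (≤-trans (<⇒≤ u+2<n) (n≤1+n n)))
                                                        (≤-trans u+2<n (n≤1+n n)))

  neighbourSum-n′ : ∀ X → neighbourSum n′ X ≡ X (suc (suc r))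
  neighbourSum-n′ X = trans (neighbourSum-cong n′ X _ counts-n′) (parity-at (suc n) _ X (s≤s (≤-trans (n≤1+n _) (n≤1+n _))))

  neighbourSum-n : ∀ X → neighbourSum n X ≡ X n′
  neighbourSum-n X = trans (neighbourSum-cong n X _ counts-n) (parity-at (suc n) _ X (s≤s (n≤1+n _)))

  _∼_ : Labeling (suc n) → Labeling (suc n) → Set
  x ∼ y = x ∼⟨ Btilde n ⟩ y

  step : Fin (suc n) → Labeling (suc n) → Labeling (suc n)
  step = move (Btilde n)

  step-flips : ∀ x i → FlipAt (get x) (get (step i x)) (toℕ i) (neighbourSum (toℕ i) (get x))
  step-flips x i = elsewhere , at
    where
    v : ℕ
    v = toℕ i
    c : Bool
    c = lookup x i xor xorSum (λ k → edge (Btilde n) i k ∧ not (double (Btilde n) i k) ∧ lookup x k)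
    c≡ : c ≡ get x v xor neighbourSum v (get x)
    c≡ = cong₂ _xor_ (get-lookup x i) (xorSum≡parity _ (λ k → counts v k ∧ get x k) λ k →
      trans (sym (∧-assoc (adjB n v (toℕ k) ∨ adjB n (toℕ k) v) _ _)) (cong (counts v (toℕ k) ∧_) (get-lookup x k)))
    elsewhere : ∀ m → m ≢ v → get (step i x) m ≡ get x m
    elsewhere m m≢v = trans (get-[]≔ x i c m) (cong (λ b → if b then c else get x m) (≢⇒≡ᵇ≡false m≢v))
    at : get (step i x) v ≡ get x v xor neighbourSum v (get x)
    at = trans (get-[]≔ x i c v) (trans (cong (λ b → if b then c else get x v) (≡ᵇ-refl v)) c≡)

  -- The differences Δ and the action of the moves on them

  -- G (get x) is the folded labeling G of the header, and diff x is Δ.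
  G : (ℕ → Bool) → ℕ → Bool
  G X zero          = false
  G X (suc zero)    = X 0 xor X 1
  G X (suc (suc m)) = (suc (suc m) <ᵇ n) ∧ X (suc (suc m))

  diff : Labeling (suc n) → Vec Bool n
  diff x = tabulate (differences (G (get x)) ∘ toℕ)

  weight : Labeling (suc n) → ℕ
  weight x = ones (diff x)

  get-diff : ∀ x m → m < n → get (diff x) m ≡ differences (G (get x)) m
  get-diff x = get-tabulate (differences (G (get x)))

  G-cong : ∀ {X Y} → (∀ m → m < n → X m ≡ Y m) → ∀ m → G X m ≡ G Y m
  G-cong X≗Y zero          = refl
  G-cong X≗Y (suc zero)    = cong₂ _xor_ (X≗Y 0 z<s) (X≗Y 1 (s≤s z<s))
  G-cong X≗Y (suc (suc m)) with suc (suc m) <ᵇ n in lt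
  ... | true  = X≗Y _ (<ᵇ⇒< _ _ (subst T (sym lt) tt))
  ... | false = refl

  G-< : ∀ X m → suc (suc m) < n → G X (suc (suc m)) ≡ X (suc (suc m))
  G-< X m lt = cong (_∧ X (suc (suc m))) (T⇒≡true (<⇒<ᵇ lt))

  G-≥ : ∀ X {m} → n ≤ m → G X m ≡ false
  G-≥ X {suc zero}    (s≤s ())
  G-≥ X {suc (suc m)} n≤m = cong (_∧ X (suc (suc m))) (¬T⇒≡false (λ t → ≤⇒≯ n≤m (<ᵇ⇒< _ _ t)))

  G-flip-low : ∀ {X X′ v s} → v ≤ 1 → FlipAt X X′ v s → FlipAt (G X) (G X′) 1 s
  G-flip-low {X} {X′} {v} {s} v≤1 flip = G-same v≤1 flip , G-flipped v≤1 flip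
    where
    G-same : ∀ {v} → v ≤ 1 → FlipAt X X′ v s → ∀ m → m ≢ 1 → G X′ m ≡ G X m
    G-same v≤1 _           zero          _   = refl
    G-same v≤1 _           (suc zero)    m≢1 = ⊥-elim (m≢1 refl)
    G-same v≤1 (same , _)  (suc (suc m)) _   =
      cong (_ ∧_) (same _ (λ eq → <⇒≱ (s≤s (s≤s z≤n)) (subst (_≤ 1) (sym eq) v≤1)))
    G-flipped : ∀ {v} → v ≤ 1 → FlipAt X X′ v s → G X′ 1 ≡ G X 1 xor s
    G-flipped z≤n       (same , flipped) rewrite flipped | same 1 (λ ()) =
      trans (xor-assoc (X 0) s (X 1)) (trans (cong (X 0 xor_) (xor-comm s (X 1))) (sym (xor-assoc (X 0) (X 1) s)))
    G-flipped (s≤s z≤n) (same , flipped) rewrite flipped | same 0 (λ ()) = sym (xor-assoc (X 0) (X 1) s)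

  G-flip-high : ∀ {X X′ u s} → suc (suc u) < n → FlipAt X X′ (suc (suc u)) s → FlipAt (G X) (G X′) (suc (suc u)) s
  G-flip-high {X} {X′} {u} {s} lt (same , flipped) = G-same , trans (G-< X′ u lt) (trans flipped (cong (_xor s) (sym (G-< X u lt))))
    where
    G-same : ∀ m → m ≢ suc (suc u) → G X′ m ≡ G X m
    G-same zero          _ = refl
    G-same (suc zero)    _ = cong₂ _xor_ (same 0 (λ ())) (same 1 (λ ()))
    G-same (suc (suc m)) m≢ = cong (_ ∧_) (same _ m≢)

  pivot : ℕ → ℕ
  pivot zero    = zero
  pivot (suc v) = v

  neighbourSum-G : ∀ X v → v < n → neighbourSum v X ≡ G X (pivot v) xor G X (suc (suc (pivot v)))
  neighbourSum-G X 0 _ = trans (neighbourSum-low X z≤n) (sym (G-< X 0 (s≤s (s≤s (s≤s z≤n)))))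
  neighbourSum-G X 1 _ = trans (neighbourSum-low X (s≤s z≤n)) (sym (G-< X 0 (s≤s (s≤s (s≤s z≤n)))))
  neighbourSum-G X 2 _ =
    trans (neighbourSum-2 X) (trans (sym (xor-assoc (X 0) (X 1) (X 3)))
                                    (cong ((X 0 xor X 1) xor_) (sym (G-< X 1 (s≤s (s≤s (s≤s (s≤s z≤n))))))))
  neighbourSum-G X (suc (suc (suc u))) v<n with suc (suc (suc u)) ≟ n′
  ... | yes refl = trans (neighbourSum-n′ X)
                         (sym (trans (cong₂ _xor_ (G-< X r (s≤s (s≤s (s≤s (n≤1+n r))))) (G-≥ X ≤-refl)) (xor-identityʳ _)))
  ... | no v≢n′ = trans (neighbourSum-mid X (s≤s (s≤s z≤n)) v+1<n)
                        (sym (cong₂ _xor_ (G-< X u v-1<n) (G-< X (suc (suc u)) v+1<n)))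
    where
    v+1<n : suc (suc (suc (suc u))) < n
    v+1<n = s≤s (≤∧≢⇒< (≤-pred v<n) v≢n′)
    v-1<n : suc (suc u) < n
    v-1<n = ≤-trans (n≤1+n _) v<n

  G-flip : ∀ {X X′ v s} → v < n → FlipAt X X′ v s → FlipAt (G X) (G X′) (suc (pivot v)) s
  G-flip {v = 0}           _   = G-flip-low z≤n
  G-flip {v = 1}           _   = G-flip-low (s≤s z≤n)
  G-flip {v = suc (suc u)} v<n = G-flip-high v<n

  G-step : ∀ x i → toℕ i < n → let X = get x ; a = pivot (toℕ i) in
           FlipAt (G X) (G (get (step i x))) (suc a) (G X a xor G X (suc (suc a)))
  G-step x i v<n = subst (FlipAt _ _ _) (neighbourSum-G (get x) (toℕ i) v<n) (G-flip v<n (step-flips x i))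

  suc-pivot< : ∀ {v} → v < n → suc (pivot v) < n
  suc-pivot< {zero}  _   = s≤s (s≤s z≤n)
  suc-pivot< {suc v} v<n = v<n

  diff-step : ∀ x i → toℕ i < n → diff (step i x) ≡ swapAt (pivot (toℕ i)) (diff x)
  diff-step x i v<n = get-extensional _ _ λ m m<n → begin
    get (diff (step i x)) m                 ≡⟨ get-diff (step i x) m m<n ⟩
    differences (G (get (step i x))) m      ≡⟨ differences-flip a (G-step x i v<n) m ⟩
    swapF a (differences (G (get x))) m     ≡⟨ swapF-cong n a m (λ j j<n → sym (get-diff x j j<n)) m<n (suc-pivot< v<n) ⟩
    swapF a (get (diff x)) m                ≡⟨ get-swapAt a (diff x) m (suc-pivot< v<n) ⟨
    get (swapAt a (diff x)) m               ∎
    where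
    open ≡-Reasoning
    a : ℕ
    a = pivot (toℕ i)

  diff-step-n : ∀ x i → toℕ i ≡ n → diff (step i x) ≡ diff x
  diff-step-n x i v≡n = get-extensional _ _ λ m m<n → begin
    get (diff (step i x)) m                 ≡⟨ get-diff (step i x) m m<n ⟩
    differences (G (get (step i x))) m      ≡⟨ cong₂ _xor_ (G-unchanged m) (G-unchanged (suc m)) ⟩
    differences (G (get x)) m               ≡⟨ get-diff x m m<n ⟨
    get (diff x) m                          ∎
    where
    open ≡-Reasoning
    G-unchanged : ∀ m → G (get (step i x)) m ≡ G (get x) m
    G-unchanged = G-cong (λ m m<n → proj₁ (step-flips x i) m (λ m≡v → <-irrefl (trans m≡v v≡n) m<n))

  weight-step : ∀ x i → weight (step i x) ≡ weight x
  weight-step x i with m≤n⇒m<n∨m≡n (≤-pred (toℕ<n i))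
  ... | inj₁ v<n = trans (cong ones (diff-step x i v<n)) (ones-swapAt (pivot (toℕ i)) (diff x))
  ... | inj₂ v≡n = cong ones (diff-step-n x i v≡n)

  get-step-at-0 : ∀ x i → toℕ i ≡ 0 → get (step i x) 0 ≡ get x 0 xor get x 2
  get-step-at-0 x i v≡0 =
    trans (subst (λ v → get (step i x) v ≡ get x v xor neighbourSum (toℕ i) (get x)) v≡0 (proj₂ (step-flips x i)))
          (cong (get x 0 xor_) (neighbourSum-low (get x) (subst (_≤ 1) (sym v≡0) z≤n)))

  get-step-at-n : ∀ x i → toℕ i ≡ n → get (step i x) n ≡ get x n xor get x n′
  get-step-at-n x i v≡n =
    trans (subst (λ v → get (step i x) v ≡ get x v xor neighbourSum (toℕ i) (get x)) v≡n (proj₂ (step-flips x i)))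
          (cong (get x n xor_) (subst (λ v → neighbourSum v (get x) ≡ get x n′) (sym v≡n) (neighbourSum-n (get x))))

  get-2 : ∀ x → get x 2 ≡ get (diff x) 0 xor get (diff x) 1
  get-2 x rewrite get-diff x 0 z<s | get-diff x 1 (s≤s z<s) = sym (xor-cancelˡ (G (get x) 1) (get x 2))

  get-n′ : ∀ x → get x n′ ≡ get (diff x) n′
  get-n′ x rewrite get-diff x n′ ≤-refl | G-≥ (get x) {n} ≤-refl | G-< (get x) (suc r) ≤-refl = sym (xor-identityʳ _)

  SameEnds : Labeling (suc n) → Labeling (suc n) → Set
  SameEnds x y = get y 0 ≡ get x 0 × get y n ≡ get x n

  ReachableWithDiff : Labeling (suc n) → Vec Bool n → Set
  ReachableWithDiff x E = ∃[ y ] x ∼ y × diff y ≡ E × SameEnds x y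

  swap-vertex : ∀ a → suc a < n → Fin (suc n)
  swap-vertex a a+1<n = fromℕ< (m≤n⇒m≤1+n a+1<n)

  step-swap-vertex : ∀ a a+1<n x → let y = step (swap-vertex a a+1<n) x in diff y ≡ swapAt a (diff x) × SameEnds x y
  step-swap-vertex a a+1<n x =
    trans (diff-step x i (subst (_< n) (sym v≡a+1) a+1<n)) (cong (λ v → swapAt (pivot v) (diff x)) v≡a+1) ,
    proj₁ (step-flips x i) 0 (λ 0≡v → 0≢1+n (trans 0≡v v≡a+1)) ,
    proj₁ (step-flips x i) n (λ n≡v → <-irrefl (trans (sym v≡a+1) (sym n≡v)) a+1<n)
    where
    i : Fin (suc n)
    i = swap-vertex a a+1<n
    v≡a+1 : toℕ i ≡ suc a
    v≡a+1 = toℕ-fromℕ< (m≤n⇒m≤1+n a+1<n)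

  swaps-realised : ∀ {u E} → EqClosure (SwapStep n) u E → ∀ x → diff x ≡ u → ReachableWithDiff x E
  swaps-realised ε x d≡u = x , ε , d≡u , refl , refl
  swaps-realised (fwd (a , a+1<n , v≡) ◅ rest) x d≡u =
    let (d₁ , e0 , en) = step-swap-vertex a a+1<n x
        (y , x₁∼y , dy , f0 , fn) = swaps-realised rest _ (trans d₁ (trans (cong (swapAt a) d≡u) (sym v≡)))
    in y , move-∼ (Btilde n) x _ ◅◅ x₁∼y , dy , trans f0 e0 , trans fn en
  swaps-realised (bwd (a , a+1<n , u≡) ◅ rest) x d≡u =
    let (d₁ , e0 , en) = step-swap-vertex a a+1<n x
        (y , x₁∼y , dy , f0 , fn) = swaps-realised rest _ (trans d₁ (trans (cong (swapAt a) (trans d≡u u≡)) (swapAt-involutive a _)))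
    in y , move-∼ (Btilde n) x _ ◅◅ x₁∼y , dy , trans f0 e0 , trans fn en

  realise-diff : ∀ x E → ones E ≡ weight x → ReachableWithDiff x E
  realise-diff x E ones≡ = swaps-realised (swaps-connect (diff x) E (sym ones≡)) x refl

  G-from-diff : ∀ x m → m ≤ n → G (get x) m ≡ parity m (get (diff x))
  G-from-diff x m m≤n =
    trans (telescope (G (get x)) refl m) (parity-cong m (λ j j<m → sym (get-diff x j (<-≤-trans j<m m≤n))))

  labeling-determined : ∀ x y → diff x ≡ diff y → get x 0 ≡ get y 0 → get x n ≡ get y n → x ≡ y
  labeling-determined x y d≡ x0≡ xn≡ = get-extensional x y agree
    where
    G≡ : ∀ m → m ≤ n → G (get x) m ≡ G (get y) m
    G≡ m m≤n = trans (G-from-diff x m m≤n) (trans (cong (λ d → parity m (get d)) d≡) (sym (G-from-diff y m m≤n)))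
    agree : ∀ m → m < suc n → get x m ≡ get y m
    agree zero       _ = x0≡
    agree (suc zero) _ = begin
      get x 1                        ≡⟨ xor-cancelˡ (get x 0) (get x 1) ⟨
      get x 0 xor G (get x) 1        ≡⟨ cong₂ _xor_ x0≡ (G≡ 1 (s≤s z≤n)) ⟩
      get y 0 xor G (get y) 1        ≡⟨ xor-cancelˡ (get y 0) (get y 1) ⟩
      get y 1                        ∎
      where open ≡-Reasoning
    agree (suc (suc m)) m<n+1 with m≤n⇒m<n∨m≡n (≤-pred m<n+1)
    ... | inj₁ m<n  = trans (sym (G-< (get x) m m<n)) (trans (G≡ _ (<⇒≤ m<n)) (G-< (get y) m m<n))
    ... | inj₂ refl = xn≡

  ∼-from-invariants : ∀ x y → weight x ≡ weight y → get x 0 ≡ get y 0 → get x n ≡ get y n → x ∼ y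
  ∼-from-invariants x y w≡ x0≡ xn≡ =
    let (z , x∼z , dz , z0 , zn) = realise-diff x (diff y) (sym w≡)
    in subst (x ∼_) (labeling-determined z y dz (trans z0 x0≡) (trans zn xn≡)) x∼z

  -- Invariants and equivalence

  weight-even : ∀ x → ∃[ h ] weight x ≡ h + h
  weight-even x with count≡double+parity n (get (diff x))
  ... | h , e = h , (begin
    weight x                                ≡⟨ ones≡count (diff x) ⟩
    count n (get (diff x))                  ≡⟨ e ⟩
    h + h + bit (parity n (get (diff x)))
      ≡⟨ cong (λ b → h + h + bit b) (trans (sym (G-from-diff x n ≤-refl)) (G-≥ (get x) ≤-refl)) ⟩
    h + h + 0                               ≡⟨ +-identityʳ _ ⟩
    h + h                                   ∎)
    where open ≡-Reasoning

  G-count≤ones : ∀ x → count (suc n) (G (get x)) ≤ ones x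
  G-count≤ones x = begin
    bit (X 0 xor X 1) + count n′ (G X ∘ suc ∘ suc)
      ≤⟨ +-mono-≤ (bit-xor-≤ (X 0) (X 1))
                  (count-mono n′ {G X ∘ suc ∘ suc} {X ∘ suc ∘ suc} (λ m → bit-∧-≤ (suc (suc m) <ᵇ n) (X (suc (suc m))))) ⟩
    bit (X 0) + bit (X 1) + count n′ (X ∘ suc ∘ suc)
      ≡⟨ +-assoc (bit (X 0)) (bit (X 1)) (count n′ (X ∘ suc ∘ suc)) ⟩
    count (suc n) X
      ≡⟨ ones≡count {suc n} x ⟨
    ones x ∎
    where
    open ≤-Reasoning
    X : ℕ → Bool
    X = get x
    bit-∧-≤ : ∀ a b → bit (a ∧ b) ≤ bit b
    bit-∧-≤ false b = z≤n
    bit-∧-≤ true  b = ≤-refl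

  weight≤2ones : ∀ x → weight x ≤ ones x + ones x
  weight≤2ones x = begin
    weight x                                     ≡⟨ ones≡count (diff x) ⟩
    count n (get (diff x))                       ≡⟨ count-cong n (get-diff x) ⟩
    count n (differences (G X))                  ≤⟨ count-xor-≤ n (G X) (G X ∘ suc) ⟩
    count n (G X) + count n (G X ∘ suc)
      ≤⟨ +-monoˡ-≤ (count (suc n) (G X)) (≤-trans (m≤m+n (count n (G X)) _) (≤-reflexive (sym (count-snoc n (G X))))) ⟩
    count (suc n) (G X) + count (suc n) (G X)    ≤⟨ +-mono-≤ (G-count≤ones x) (G-count≤ones x) ⟩
    ones x + ones x                              ∎
    where
    open ≤-Reasoning
    X : ℕ → Bool
    X = get x

  tag-n : Labeling (suc n) → Bool
  tag-n x = (weight x ≡ᵇ 0) ∧ get x n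

  tag-n-step : ∀ x i → tag-n (step i x) ≡ tag-n x
  tag-n-step x i rewrite weight-step x i with weight x ≡ᵇ 0 in w≡0
  ... | false = refl
  ... | true with toℕ i ≟ n
  ...   | no  v≢n = proj₁ (step-flips x i) n (v≢n ∘ sym)
  ...   | yes v≡n = trans (get-step-at-n x i v≡n) (trans (cong (get x n xor_) xn′≡false) (xor-identityʳ _))
    where
    xn′≡false : get x n′ ≡ false
    xn′≡false = trans (get-n′ x) (ones≡0⇒get≡false (diff x) (≡ᵇ⇒≡ _ 0 (subst T (sym w≡0) tt)) n′)

  extreme : ℕ → Bool
  extreme w = (w ≡ᵇ 0) ∨ (w ≡ᵇ n)

  get-2-extreme : ∀ x → T (extreme (weight x)) → get x 2 ≡ false
  get-2-extreme x t with to (T-∨ {weight x ≡ᵇ 0}) t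
  ... | inj₁ w≡0 = trans (get-2 x) (cong₂ _xor_ (all-false 0) (all-false 1))
    where
    all-false : ∀ m → get (diff x) m ≡ false
    all-false = ones≡0⇒get≡false (diff x) (≡ᵇ⇒≡ _ 0 w≡0)
  ... | inj₂ w≡n = trans (get-2 x) (cong₂ _xor_ (all-true 0 z<s) (all-true 1 (s≤s z<s)))
    where
    all-true : ∀ m → m < n → get (diff x) m ≡ true
    all-true = ones≡length⇒get≡true (diff x) (≡ᵇ⇒≡ _ n w≡n)

  tag-0 : Labeling (suc n) → Bool
  tag-0 x = extreme (weight x) ∧ get x 0

  tag-0-step : ∀ x i → tag-0 (step i x) ≡ tag-0 x
  tag-0-step x i rewrite weight-step x i with extreme (weight x) in ext
  ... | false = refl
  ... | true with toℕ i ≟ 0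
  ...   | no  v≢0 = proj₁ (step-flips x i) 0 (v≢0 ∘ sym)
  ...   | yes v≡0 =
    trans (get-step-at-0 x i v≡0) (trans (cong (get x 0 xor_) (get-2-extreme x (subst T (sym ext) tt))) (xor-identityʳ _))

  step-n-flip : ∀ y → get y n′ ≡ true → let z = step (fromℕ n) y in
                weight z ≡ weight y × get z 0 ≡ get y 0 × get z n ≡ not (get y n)
  step-n-flip y yn′≡true =
    weight-step y (fromℕ n) ,
    proj₁ (step-flips y (fromℕ n)) 0 (λ 0≡v → 0≢1+n (trans 0≡v (toℕ-fromℕ n))) ,
    trans (get-step-at-n y (fromℕ n) (toℕ-fromℕ n)) (trans (cong (get y n xor_) yn′≡true) (xor-trueʳ (get y n)))

  step-0-flip : ∀ y → get y 2 ≡ true → let z = step Fin.zero y in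
                weight z ≡ weight y × get z 0 ≡ not (get y 0) × get z n ≡ get y n
  step-0-flip y y2≡true =
    weight-step y Fin.zero ,
    trans (get-step-at-0 y Fin.zero refl) (trans (cong (get y 0 xor_) y2≡true) (xor-trueʳ (get y 0))) ,
    proj₁ (step-flips y Fin.zero) n (λ ())

  flip-n : ∀ x → 0 < weight x → ∃[ y ] x ∼ y × weight y ≡ weight x × get y 0 ≡ get x 0 × get y n ≡ not (get x n)
  flip-n x w>0 =
    let (y , x∼y , dy , y0 , yn) = realise-diff x E ones-E
        (wz , z0 , zn) = step-n-flip y (trans (get-n′ y) (trans (cong (λ d → get d n′) dy) (get-trailing-last n′ (weight x) w>0)))
    in step (fromℕ n) y , x∼y ◅◅ move-∼ (Btilde n) y _ ,
       trans wz (trans (cong ones dy) ones-E) , trans z0 y0 , trans zn (cong not yn)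
    where
    E : Vec Bool n
    E = trailing n (weight x)
    ones-E : ones E ≡ weight x
    ones-E = ones-trailing n (weight x) (ones≤length (diff x))

  flip-0 : ∀ x → 0 < weight x → weight x < n → ∃[ y ] x ∼ y × weight y ≡ weight x × get y 0 ≡ not (get x 0) × get y n ≡ get x n
  flip-0 x w>0 w<n =
    let (y , x∼y , dy , y0 , yn) = realise-diff x E ones-E
        (wz , z0 , zn) = step-0-flip y (trans (get-2 y) (trans (cong (λ d → get d 0 xor get d 1) dy)
                                                                (sorted-head (suc (suc r)) (weight x) w>0)))
    in step Fin.zero y , x∼y ◅◅ move-∼ (Btilde n) y _ ,
       trans wz (trans (cong ones dy) ones-E) , trans z0 (cong not y0) , trans zn yn
    where
    E : Vec Bool n
    E = false ∷ sorted n′ (weight x)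
    ones-E : ones E ≡ weight x
    ones-E = ones-sorted n′ (weight x) (≤-pred w<n)

  set-0 : ∀ x b → 0 < weight x → weight x < n → ∃[ y ] x ∼ y × weight y ≡ weight x × get y 0 ≡ b × get y n ≡ get x n
  set-0 x b w>0 w<n with get x 0 ≟ᵇ b
  ... | yes x0≡b = x , ε , refl , x0≡b , refl
  ... | no  x0≢b = let (y , x∼y , wy , y0 , yn) = flip-0 x w>0 w<n in y , x∼y , wy , trans y0 (≢⇒not≡ x0≢b) , yn

  set-n : ∀ x b → 0 < weight x → ∃[ y ] x ∼ y × weight y ≡ weight x × get y 0 ≡ get x 0 × get y n ≡ b
  set-n x b w>0 with get x n ≟ᵇ b
  ... | yes xn≡b = x , ε , refl , refl , xn≡b
  ... | no  xn≢b = let (y , x∼y , wy , y0 , yn) = flip-n x w>0 in y , x∼y , wy , y0 , trans yn (≢⇒not≡ xn≢b)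

  ∼-if-0<weight<n : ∀ x y → weight x ≡ weight y → 0 < weight x → weight x < n → x ∼ y
  ∼-if-0<weight<n x y w≡ w>0 w<n =
    let (x₁ , x∼x₁ , w₁ , x₁0 , x₁n) = set-0 x (get y 0) w>0 w<n
        (x₂ , x₁∼x₂ , w₂ , x₂0 , x₂n) = set-n x₁ (get y n) (subst (0 <_) (sym w₁) w>0)
    in x∼x₁ ◅◅ x₁∼x₂ ◅◅ ∼-from-invariants x₂ y (trans w₂ (trans w₁ w≡)) (trans x₂0 x₁0) x₂n

  ∼-if-weight≡n : ∀ x y → weight x ≡ n → weight y ≡ n → get x 0 ≡ get y 0 → x ∼ y
  ∼-if-weight≡n x y wx wy x0≡ =
    let (x₁ , x∼x₁ , w₁ , x₁0 , x₁n) = set-n x (get y n) (subst (0 <_) (sym wx) z<s)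
    in x∼x₁ ◅◅ ∼-from-invariants x₁ y (trans w₁ (trans wx (sym wy))) (trans x₁0 x0≡) x₁n

  weight-invariant : ∀ {x y} → x ∼ y → weight x ≡ weight y
  weight-invariant = ∼-invariant (Btilde n) weight weight-step

  ≡-if-weight≡0 : ∀ {x y} → x ∼ y → weight y ≡ 0 → x ≡ y
  ≡-if-weight≡0 {x} {y} x∼y wy = labeling-determined x y diff≡ x0≡ xn≡
    where
    wx : weight x ≡ 0
    wx = trans (weight-invariant x∼y) wy
    diff≡ : diff x ≡ diff y
    diff≡ = get-extensional _ _ λ m _ → trans (ones≡0⇒get≡false (diff x) wx m) (sym (ones≡0⇒get≡false (diff y) wy m))
    x0≡ : get x 0 ≡ get y 0
    x0≡ = subst₂ (λ a b → extreme a ∧ get x 0 ≡ extreme b ∧ get y 0) wx wy (∼-invariant (Btilde n) tag-0 tag-0-step x∼y)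
    xn≡ : get x n ≡ get y n
    xn≡ = subst₂ (λ a b → (a ≡ᵇ 0) ∧ get x n ≡ (b ≡ᵇ 0) ∧ get y n) wx wy (∼-invariant (Btilde n) tag-n tag-n-step x∼y)

  ones-lower-bound : ∀ {x y} j → x ∼ y → weight y ≡ j + j → j ≤ ones x
  ones-lower-bound {x} j x∼y wy =
    +-self-cancelˡ-≤ j (ones x) (subst (_≤ ones x + ones x) (trans (weight-invariant x∼y) wy) (weight≤2ones x))

  -- The listed representatives

  get-lab : ∀ P m → m ≤ n → get (lab n P) m ≡ P m
  get-lab P m m≤n = get-tabulate P m (s≤s m≤n)

  weight-lab : ∀ P → weight (lab n P) ≡ count n (differences (G P))
  weight-lab P = trans (ones≡count (diff (lab n P)))
    (count-cong n λ m m<n → trans (get-diff (lab n P) m m<n) (cong₂ _xor_ (G-lab m) (G-lab (suc m))))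
    where
    G-lab : ∀ m → G (get (lab n P)) m ≡ G P m
    G-lab = G-cong (λ m m<n → get-lab P m (<⇒≤ m<n))

  ones-lab : ∀ P → ones (lab n P) ≡ count (suc n) P
  ones-lab P = trans (ones≡count {suc n} (lab n P)) (count-cong (suc n) (λ m m<n+1 → get-lab P m (≤-pred m<n+1)))

  weight-lab-0 : ∀ P → P 0 ≡ P 1 → (∀ u → suc (suc u) < n → P (suc (suc u)) ≡ false) → weight (lab n P) ≡ 0
  weight-lab-0 P p0≡p1 inner≡false = trans (weight-lab P) (count-false n (λ m → cong₂ _xor_ (G≡false m) (G≡false (suc m))))
    where
    G≡false : ∀ m → G P m ≡ false
    G≡false zero          = refl
    G≡false (suc zero)    = trans (cong (_xor P 1) p0≡p1) (xor-same (P 1))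
    G≡false (suc (suc u)) with suc (suc u) <ᵇ n in lt
    ... | true  = inner≡false u (<ᵇ⇒< _ _ (subst T (sym lt) tt))
    ... | false = refl

  weight-ℓ₀ : weight (ℓ₀ n) ≡ 0
  weight-ℓ₀ = weight-lab-0 (λ _ → false) refl (λ _ _ → refl)

  weight-ℓ₁ : weight (ℓ₁ n) ≡ 0
  weight-ℓ₁ = weight-lab-0 (_≡ᵇ n) refl (λ _ lt → ≢⇒≡ᵇ≡false (<⇒≢ lt))

  weight-ℓ₂ : weight (ℓ₂ n) ≡ 0
  weight-ℓ₂ = weight-lab-0 (λ v → (v ≡ᵇ 0) ∨ (v ≡ᵇ 1)) refl (λ _ _ → refl)

  weight-ℓ₃ : weight (ℓ₃ n) ≡ 0
  weight-ℓ₃ = weight-lab-0 (λ v → (v ≡ᵇ 0) ∨ (v ≡ᵇ 1) ∨ (v ≡ᵇ n)) refl (λ _ lt → ≢⇒≡ᵇ≡false (<⇒≢ lt))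

  -- The position of the class among repsOdd n k or repsEven n k.
  index : ℕ → ℕ → Bool → Bool → ℕ
  index k w tn t0 =
    if w ≡ᵇ 0 then bit tn + (bit t0 + bit t0)
    else if w ≡ᵇ n then (if t0 then 3 + k else 4 + k)
    else 3 + ⌊ w /2⌋

  classIndex : ℕ → Labeling (suc n) → ℕ
  classIndex k x = index k (weight x) (tag-n x) (tag-0 x)

  classIndex-step : ∀ k x i → classIndex k (step i x) ≡ classIndex k x
  classIndex-step k x i =
    trans (cong (λ w → index k w (tag-n (step i x)) (tag-0 (step i x))) (weight-step x i))
          (cong₂ (index k (weight x)) (tag-n-step x i) (tag-0-step x i))

  classIndex-at : ∀ k y {w} → weight y ≡ w → classIndex k y ≡ index k w ((w ≡ᵇ 0) ∧ get y n) (extreme w ∧ get y 0)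
  classIndex-at k y wy = cong (λ w → index k w ((w ≡ᵇ 0) ∧ get y n) (extreme w ∧ get y 0)) wy

  classIndex-weight0 : ∀ k y → weight y ≡ 0 → classIndex k y ≡ bit (get y n) + (bit (get y 0) + bit (get y 0))
  classIndex-weight0 k y wy = classIndex-at k y wy

  classIndex-even : ∀ k y j → weight y ≡ suc j + suc j → suc j + suc j ≢ n → classIndex k y ≡ 3 + suc j
  classIndex-even k y j wy w≢n = trans (classIndex-at k y wy) (index-j ((suc j + suc j ≡ᵇ 0) ∧ get y n) _)
    where
    index-j : ∀ tn t0 → index k (suc j + suc j) tn t0 ≡ 3 + suc j
    index-j tn t0 rewrite ≢⇒≡ᵇ≡false w≢n = cong (3 +_) (⌊n+n/2⌋≡n (suc j))

  classIndex-full : ∀ k y → weight y ≡ n → classIndex k y ≡ (if get y 0 then 3 + k else 4 + k)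
  classIndex-full k y wy = trans (classIndex-at k y wy) (index-n ((n ≡ᵇ 0) ∧ get y n))
    where
    index-n : ∀ tn → index k n tn (extreme n ∧ get y 0) ≡ (if get y 0 then 3 + k else 4 + k)
    index-n tn rewrite ≡ᵇ-refl r = refl

  ℓ : Bool → Bool → Labeling (suc n)
  ℓ false false = ℓ₀ n
  ℓ false true  = ℓ₁ n
  ℓ true  false = ℓ₂ n
  ℓ true  true  = ℓ₃ n

  ℓ-properties : ∀ b₀ bₙ → weight (ℓ b₀ bₙ) ≡ 0 × get (ℓ b₀ bₙ) 0 ≡ b₀ × get (ℓ b₀ bₙ) n ≡ bₙ
  ℓ-properties false false = weight-ℓ₀ , refl , get-lab (λ _ → false) n ≤-refl
  ℓ-properties false true  = weight-ℓ₁ , refl , trans (get-lab (_≡ᵇ n) n ≤-refl) (≡ᵇ-refl n)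
  ℓ-properties true  false = weight-ℓ₂ , refl , get-lab (λ v → (v ≡ᵇ 0) ∨ (v ≡ᵇ 1)) n ≤-refl
  ℓ-properties true  true  =
    weight-ℓ₃ , refl , trans (get-lab (λ v → (v ≡ᵇ 0) ∨ (v ≡ᵇ 1) ∨ (v ≡ᵇ n)) n ≤-refl) (≡ᵇ-refl n)

  ℓ-index<4 : ∀ b₀ bₙ → bit bₙ + (bit b₀ + bit b₀) < 4
  ℓ-index<4 false false = s≤s z≤n
  ℓ-index<4 false true  = s≤s (s≤s z≤n)
  ℓ-index<4 true  false = s≤s (s≤s (s≤s z≤n))
  ℓ-index<4 true  true  = s≤s (s≤s (s≤s (s≤s z≤n)))

  classIndex-ℓ : ∀ k b₀ bₙ → classIndex k (ℓ b₀ bₙ) ≡ bit bₙ + (bit b₀ + bit b₀)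
  classIndex-ℓ k b₀ bₙ = let (w , e₀ , eₙ) = ℓ-properties b₀ bₙ in
    trans (classIndex-weight0 k (ℓ b₀ bₙ) w) (cong₂ (λ p q → bit q + (bit p + bit p)) e₀ eₙ)

  ∼-ℓ : ∀ x → weight x ≡ 0 → x ∼ ℓ (get x 0) (get x n)
  ∼-ℓ x wx = let (w , e₀ , eₙ) = ℓ-properties (get x 0) (get x n) in ∼-from-invariants x _ (trans wx (sym w)) (sym e₀) (sym eₙ)

  ones-ℓ-minimal : ∀ b₀ bₙ x → x ∼ ℓ b₀ bₙ → ones (ℓ b₀ bₙ) ≤ ones x
  ones-ℓ-minimal b₀ bₙ x x∼ℓ = ≤-reflexive (cong ones (sym (≡-if-weight≡0 x∼ℓ (proj₁ (ℓ-properties b₀ bₙ)))))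

  module EvensUpTo (a : ℕ) (2a+2<n : 2 * suc a < n) where

    P : ℕ → Bool
    P v = (2 ≤ᵇ v) ∧ (v ≤ᵇ 2 * suc a) ∧ isEven v

    2a<n-2 : 2 * a < suc (suc r)
    2a<n-2 = ≤-pred (≤-pred (subst (_< n) (*-suc 2 a) 2a+2<n))

    G-P : ∀ m → G P m ≡ P m
    G-P zero          = refl
    G-P (suc zero)    = refl
    G-P (suc (suc u)) with suc (suc u) <ᵇ n in lt
    ... | true  = refl
    ... | false = sym (cong (_∧ isEven (suc (suc u))) (¬T⇒≡false (λ t → <⇒≱ 2a+2<n (≤-trans n≤u+2 (≤ᵇ⇒≤ _ _ t)))))
      where
      n≤u+2 : n ≤ suc (suc u)
      n≤u+2 = ≮⇒≥ (λ u+2<n → subst T lt (<⇒<ᵇ u+2<n))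

    weight-evens : weight (evensUpTo n (suc a)) ≡ suc a + suc a
    weight-evens = begin
      weight (lab n P)                                      ≡⟨ weight-lab P ⟩
      count n (differences (G P))                           ≡⟨ count-cong n (λ m _ → cong₂ _xor_ (G-P m) (G-P (suc m))) ⟩
      bit (P 2) + count (suc (suc r)) (differences P ∘ suc ∘ suc)
        ≡⟨ cong₂ (λ b c → bit b + c) (evenUpTo-+2 a 0) (count-cong (suc (suc r)) (λ u _ →
             trans (cong₂ _xor_ (evenUpTo-+2 a u) (evenUpTo-+2 a (suc u))) (differences-evenUpTo a u))) ⟩
      suc (count (suc (suc r)) (_≤ᵇ 2 * a))                 ≡⟨ cong suc (count-≤ᵇ (suc (suc r)) (2 * a) 2a<n-2) ⟩
      suc (suc (2 * a))                                     ≡⟨ double-suc a ⟩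
      suc a + suc a                                         ∎
      where
      open ≡-Reasoning
      double-suc : ∀ a → suc (suc (2 * a)) ≡ suc a + suc a
      double-suc = solve-∀

    ones-evens : ones (evensUpTo n (suc a)) ≡ suc a
    ones-evens = trans (ones-lab P) (trans (count-cong n′ (λ u _ → evenUpTo-+2 a u))
                                           (count-evenUpTo n′ a (≤-trans 2a<n-2 (n≤1+n _))))

    ∼-evens : ∀ x → weight x ≡ suc a + suc a → x ∼ evensUpTo n (suc a)
    ∼-evens x wx = ∼-if-0<weight<n x _ (trans wx (sym weight-evens)) (subst (0 <_) (sym wx) z<s)
                     (subst (_< n) (sym (trans wx (cong (suc a +_) (sym (+-identityʳ (suc a)))))) 2a+2<n)

    evens-minimal : ∀ x → x ∼ evensUpTo n (suc a) → ones (evensUpTo n (suc a)) ≤ ones x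
    evens-minimal x x∼ = subst (_≤ ones x) (sym ones-evens) (ones-lower-bound (suc a) x∼ weight-evens)

  oddInner : ℕ → Bool
  oddInner v = (3 ≤ᵇ v) ∧ (v ≤ᵇ n ∸ 1) ∧ not (isEven v)

  -- Describes oddsWith0 n and oddsWith1 n when n = 2a + 4.
  module Odds (P : ℕ → Bool) (P₀+P₁ : bit (P 0) + bit (P 1) ≡ 1 × P 0 xor P 1 ≡ true)
              (P-+2 : ∀ u → P (suc (suc u)) ≡ oddInner (suc (suc u))) (a : ℕ) (r≡2a : r ≡ 2 * a) where

    oddInner-odd : ∀ u → suc (suc u) < n → oddInner (suc (suc u)) ≡ not (isEven (suc (suc u)))
    oddInner-odd zero    _     = refl
    oddInner-odd (suc u) u+3<n = cong (λ b → b ∧ not (isEven (suc (suc (suc u))))) (T⇒≡true (≤⇒≤ᵇ (≤-pred u+3<n)))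

    G-P : ∀ m → 0 < m → m < n → G P m ≡ not (isEven m)
    G-P (suc zero)    _ _   = proj₂ P₀+P₁
    G-P (suc (suc u)) _ m<n = trans (G-< P u m<n) (trans (P-+2 u) (oddInner-odd u m<n))

    n′-odd : not (isEven n′) ≡ true
    n′-odd = cong not (trans (isEven-+2 (suc r)) (trans (isEven-suc r) (cong not (trans (cong isEven r≡2a) (isEven-double a)))))

    differences-G-P : ∀ m → m < n → differences (G P) m ≡ true
    differences-G-P zero    _   = proj₂ P₀+P₁
    differences-G-P (suc m) m<n with m≤n⇒m<n∨m≡n (≤-pred m<n)
    ... | inj₁ m+1<n′ = begin
      G P (suc m) xor G P (suc (suc m))           ≡⟨ cong₂ _xor_ (G-P (suc m) z<s m<n) (G-P (suc (suc m)) z<s (s≤s m+1<n′)) ⟩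
      not (isEven (suc m)) xor not (isEven (suc (suc m)))
                                                  ≡⟨ cong (λ b → not (isEven (suc m)) xor not b) (isEven-suc (suc m)) ⟩
      not (isEven (suc m)) xor not (not (isEven (suc m)))
                                                  ≡⟨ xor-inverseʳ (not (isEven (suc m))) ⟩
      true                                        ∎
      where open ≡-Reasoning
    ... | inj₂ refl = trans (cong₂ _xor_ (G-P n′ z<s ≤-refl) (G-≥ P ≤-refl)) (trans (xor-identityʳ _) n′-odd)

    weight-odds : weight (lab n P) ≡ n
    weight-odds = trans (weight-lab P) (count-true n differences-G-P)

    oddInner-+3 : ∀ u → oddInner (suc (suc (suc u))) ≡ evenUpTo a u
    oddInner-+3 u = cong₂ _∧_ (trans (≤ᵇ-+2 (suc u) (suc r)) (trans (≤ᵇ-suc u r) (cong (u ≤ᵇ_) r≡2a)))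
                       (trans (cong not (trans (isEven-+2 (suc u)) (isEven-suc u))) (not-involutive (isEven u)))

    ones-odds : ones (lab n P) ≡ suc (suc a)
    ones-odds = begin
      ones (lab n P)                                                   ≡⟨ ones-lab P ⟩
      bit (P 0) + (bit (P 1) + count n′ (P ∘ suc ∘ suc))               ≡⟨ +-assoc (bit (P 0)) _ _ ⟨
      bit (P 0) + bit (P 1) + count n′ (P ∘ suc ∘ suc)
        ≡⟨ cong₂ _+_ (proj₁ P₀+P₁) (count-cong n′ (λ u _ → P-+2 u)) ⟩
      1 + count n′ (oddInner ∘ suc ∘ suc)
        ≡⟨ cong suc (count-cong (suc (suc r)) (λ u _ → oddInner-+3 u)) ⟩
      1 + count (suc (suc r)) (evenUpTo a)
        ≡⟨ cong suc (count-evenUpTo (suc (suc r)) a (subst (_< suc (suc r)) r≡2a (n≤1+n _))) ⟩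
      suc (suc a)                                                      ∎
      where open ≡-Reasoning

    ∼-odds : ∀ x → weight x ≡ n → get x 0 ≡ P 0 → x ∼ lab n P
    ∼-odds x wx x0 = ∼-if-weight≡n x _ wx weight-odds x0

    odds-minimal : ∀ x → x ∼ lab n P → ones (lab n P) ≤ ones x
    odds-minimal x x∼ = subst (_≤ ones x) (sym ones-odds) (ones-lower-bound (suc (suc a)) x∼ n≡a+2+a+2)
      where
      n≡a+2+a+2 : weight (lab n P) ≡ suc (suc a) + suc (suc a)
      n≡a+2+a+2 = trans weight-odds (trans (cong (4 +_) r≡2a) (4+2a≡a+2+a+2 a))

  cover-weight0 : ∀ (rep : ℕ → Labeling (suc n)) → (∀ b₀ bₙ → rep (bit bₙ + (bit b₀ + bit b₀)) ≡ ℓ b₀ bₙ) →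
                  ∀ x → weight x ≡ 0 → ∃[ m ] m < 4 × x ∼ rep m
  cover-weight0 rep rep-ℓ x wx = _ , ℓ-index<4 (get x 0) (get x n) , subst (x ∼_) (sym (rep-ℓ (get x 0) (get x n))) (∼-ℓ x wx)

  classes-from-index : ∀ k c (rep : ℕ → Labeling (suc n)) →
    (∀ m → m < c → classIndex k (rep m) ≡ m) → (∀ x → ∃[ m ] m < c × x ∼ rep m) →
    (∀ m → m < c → ∀ x → x ∼ rep m → ones (rep m) ≤ ones x) →
    NumClasses (Btilde n) c × MinimalRepresentatives (Btilde n) (λ (i : Fin c) → rep (toℕ i))
  classes-from-index k c rep index-rep cover minimal =
    classes-from-invariant (Btilde n) (rep ∘ toℕ) (classIndex k) (classIndex-step k)
      (λ i → index-rep (toℕ i) (toℕ<n i)) cover-Fin (λ i → minimal (toℕ i) (toℕ<n i))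
    where
    cover-Fin : ∀ x → ∃[ i ] x ∼ rep (toℕ i)
    cover-Fin x = let (m , m<c , x∼) = cover x in fromℕ< m<c , subst (λ j → x ∼ rep j) (sym (toℕ-fromℕ< m<c)) x∼

  module Odd (k : ℕ) (n≡2k+1 : n ≡ suc (2 * k)) where

    even≢n : ∀ j → j + j ≢ n
    even≢n j j+j≡n = even≢odd j k (trans (cong (j +_) (+-identityʳ j)) (trans j+j≡n n≡2k+1))

    evens-fit : ∀ a → suc a ≤ k → 2 * suc a < n
    evens-fit a a<k = subst (2 * suc a <_) (sym n≡2k+1) (s≤s (*-monoʳ-≤ 2 a<k))

    a<k : ∀ a → 4 + a < k + 4 → a < k
    a<k a 4+a<k+4 = +-cancelˡ-< 4 a k (subst (4 + a <_) (+-comm k 4) 4+a<k+4)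

    index-reps : ∀ m → m < k + 4 → classIndex k (repsOdd n k m) ≡ m
    index-reps 0 _ = classIndex-ℓ k false false
    index-reps 1 _ = classIndex-ℓ k false true
    index-reps 2 _ = classIndex-ℓ k true  false
    index-reps 3 _ = classIndex-ℓ k true  true
    index-reps (suc (suc (suc (suc a)))) 4+a<k+4 =
      classIndex-even k (evensUpTo n (suc a)) a (EvensUpTo.weight-evens a (evens-fit a (a<k a 4+a<k+4))) (even≢n (suc a))

    repsOdd-ℓ : ∀ b₀ bₙ → repsOdd n k (bit bₙ + (bit b₀ + bit b₀)) ≡ ℓ b₀ bₙ
    repsOdd-ℓ false false = refl
    repsOdd-ℓ false true  = refl
    repsOdd-ℓ true  false = refl
    repsOdd-ℓ true  true  = refl

    cover : ∀ x → ∃[ m ] m < k + 4 × x ∼ repsOdd n k m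
    cover x with weight-even x
    ... | zero , wx = let (m , m<4 , x∼) = cover-weight0 (repsOdd n k) repsOdd-ℓ x wx in m , ≤-trans m<4 (m≤n+m 4 k) , x∼
    ... | suc a , wx = 4 + a , subst (4 + a <_) (+-comm 4 k) (+-monoʳ-< 4 a+1≤k) , EvensUpTo.∼-evens a (evens-fit a a+1≤k) x wx
      where
      w<n : suc a + suc a < n
      w<n = ≤∧≢⇒< (subst (_≤ n) wx (ones≤length (diff x))) (even≢n (suc a))
      a+1≤k : suc a ≤ k
      a+1≤k = +-self-cancelˡ-≤ (suc a) k
                (subst (suc a + suc a ≤_) (cong (k +_) (+-identityʳ k)) (≤-pred (subst (suc a + suc a <_) n≡2k+1 w<n)))

    minimal : ∀ m → m < k + 4 → ∀ x → x ∼ repsOdd n k m → ones (repsOdd n k m) ≤ ones x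
    minimal 0 _ = ones-ℓ-minimal false false
    minimal 1 _ = ones-ℓ-minimal false true
    minimal 2 _ = ones-ℓ-minimal true  false
    minimal 3 _ = ones-ℓ-minimal true  true
    minimal (suc (suc (suc (suc a)))) 4+a<k+4 = EvensUpTo.evens-minimal a (evens-fit a (a<k a 4+a<k+4))

    classes : NumClasses (Btilde n) (k + 4) × MinimalRepresentatives (Btilde n) (λ (i : Fin (k + 4)) → repsOdd n k (toℕ i))
    classes = classes-from-index k (k + 4) (repsOdd n k) index-reps cover minimal

  module Even (a : ℕ) (r≡2a : r ≡ 2 * a) where

    k : ℕ
    k = suc (suc a)

    n≡k+k : n ≡ k + k
    n≡k+k = trans (cong (4 +_) r≡2a) (4+2a≡a+2+a+2 a)

    module Odds₀ = Odds (λ v → (v ≡ᵇ 0) ∨ oddInner v) (refl , refl) (λ _ → refl) a r≡2a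
    module Odds₁ = Odds (λ v → (v ≡ᵇ 1) ∨ oddInner v) (refl , refl) (λ _ → refl) a r≡2a

    evens-fit : ∀ j → suc j < k → 2 * suc j < n
    evens-fit j j+1<k = subst₂ _<_ (cong (suc j +_) (sym (+-identityʳ (suc j)))) (sym n≡k+k) (+-mono-< j+1<k j+1<k)

    data Upper : ℕ → Set where
      evens : ∀ j → suc j < k → Upper (4 + j)
      odds₀ : Upper (3 + k)
      odds₁ : Upper (4 + k)

    upper : ∀ j → 4 + j < k + 5 → Upper (4 + j)
    upper j 4+j<k+5 with <-cmp (suc j) k
    ... | tri< j+1<k _ _ = evens j j+1<k
    ... | tri≈ _ j+1≡k _ = subst Upper (cong (3 +_) (sym j+1≡k)) odds₀
    ... | tri> _ _ k<j+1 = subst Upper (cong (4 +_) (sym (≤-antisym j≤k (≤-pred k<j+1)))) odds₁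
      where
      j≤k : j ≤ k
      j≤k = ≤-pred (+-cancelˡ-< 4 j (suc k) (subst (4 + j <_) (+-comm k 5) 4+j<k+5))

    reps-evens : ∀ j → suc j < k → repsEven n k (4 + j) ≡ evensUpTo n (suc j)
    reps-evens j j+1<k rewrite T⇒≡true (<⇒<ᵇ j+1<k) = refl

    reps-odds₀ : repsEven n k (3 + k) ≡ oddsWith0 n
    reps-odds₀ rewrite ¬T⇒≡false (<-irrefl refl ∘ <ᵇ⇒< k k) | ≡ᵇ-refl k = refl

    reps-odds₁ : repsEven n k (4 + k) ≡ oddsWith1 n
    reps-odds₁ rewrite ¬T⇒≡false (1+n≰n ∘ <⇒≤ ∘ <ᵇ⇒< (suc k) k) | ≢⇒≡ᵇ≡false {suc k} {k} (>⇒≢ ≤-refl) = refl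

    index-upper : ∀ {m} → Upper m → classIndex k (repsEven n k m) ≡ m
    index-upper (evens j j+1<k) = trans (cong (classIndex k) (reps-evens j j+1<k))
      (classIndex-even k (evensUpTo n (suc j)) j (EvensUpTo.weight-evens j (evens-fit j j+1<k))
                       (<⇒≢ (subst (suc j + suc j <_) (sym n≡k+k) (+-mono-< j+1<k j+1<k))))
    index-upper odds₀ = trans (cong (classIndex k) reps-odds₀) (classIndex-full k (oddsWith0 n) Odds₀.weight-odds)
    index-upper odds₁ = trans (cong (classIndex k) reps-odds₁) (classIndex-full k (oddsWith1 n) Odds₁.weight-odds)

    minimal-upper : ∀ {m} → Upper m → ∀ x → x ∼ repsEven n k m → ones (repsEven n k m) ≤ ones x
    minimal-upper (evens j j+1<k) x rewrite reps-evens j j+1<k = EvensUpTo.evens-minimal j (evens-fit j j+1<k) x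
    minimal-upper odds₀ x rewrite reps-odds₀ = Odds₀.odds-minimal x
    minimal-upper odds₁ x rewrite reps-odds₁ = Odds₁.odds-minimal x

    repsEven-ℓ : ∀ b₀ bₙ → repsEven n k (bit bₙ + (bit b₀ + bit b₀)) ≡ ℓ b₀ bₙ
    repsEven-ℓ false false = refl
    repsEven-ℓ false true  = refl
    repsEven-ℓ true  false = refl
    repsEven-ℓ true  true  = refl

    index-reps : ∀ m → m < k + 5 → classIndex k (repsEven n k m) ≡ m
    index-reps 0 _ = classIndex-ℓ k false false
    index-reps 1 _ = classIndex-ℓ k false true
    index-reps 2 _ = classIndex-ℓ k true  false
    index-reps 3 _ = classIndex-ℓ k true  true
    index-reps (suc (suc (suc (suc j)))) 4+j<k+5 = index-upper (upper j 4+j<k+5)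

    minimal : ∀ m → m < k + 5 → ∀ x → x ∼ repsEven n k m → ones (repsEven n k m) ≤ ones x
    minimal 0 _ = ones-ℓ-minimal false false
    minimal 1 _ = ones-ℓ-minimal false true
    minimal 2 _ = ones-ℓ-minimal true  false
    minimal 3 _ = ones-ℓ-minimal true  true
    minimal (suc (suc (suc (suc j)))) 4+j<k+5 = minimal-upper (upper j 4+j<k+5)

    cover-full : ∀ x → weight x ≡ n → ∃[ m ] m < k + 5 × x ∼ repsEven n k m
    cover-full x wx = by-x₀ (get x 0) refl
      where
      by-x₀ : ∀ b → get x 0 ≡ b → ∃[ m ] m < k + 5 × x ∼ repsEven n k m
      by-x₀ true  x0 = 3 + k , subst (3 + k <_) (+-comm 5 k) (n≤1+n (4 + k)) ,
                       subst (x ∼_) (sym reps-odds₀) (Odds₀.∼-odds x wx x0)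
      by-x₀ false x0 = 4 + k , subst (4 + k <_) (+-comm 5 k) ≤-refl ,
                       subst (x ∼_) (sym reps-odds₁) (Odds₁.∼-odds x wx x0)

    cover : ∀ x → ∃[ m ] m < k + 5 × x ∼ repsEven n k m
    cover x with weight-even x
    ... | zero , wx = let (m , m<4 , x∼) = cover-weight0 (repsEven n k) repsEven-ℓ x wx
                      in m , ≤-trans m<4 (≤-trans (n≤1+n 4) (m≤n+m 5 k)) , x∼
    ... | suc h , wx with <-cmp (suc h) k
    ...   | tri< h+1<k _ _ =
      4 + h , subst (4 + h <_) (+-comm 5 k) (+-monoʳ-≤ 5 (≤-trans (n≤1+n h) (<⇒≤ h+1<k))) ,
      subst (x ∼_) (sym (reps-evens h h+1<k)) (EvensUpTo.∼-evens h (evens-fit h h+1<k) x wx)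
    ...   | tri≈ _ h+1≡k _ = cover-full x (trans wx (trans (cong₂ _+_ h+1≡k h+1≡k) (sym n≡k+k)))
    ...   | tri> _ _ k<h+1 = ⊥-elim (<⇒≱ (subst₂ _<_ (sym n≡k+k) (sym wx) (+-mono-< k<h+1 k<h+1)) (ones≤length (diff x)))

    classes : NumClasses (Btilde n) (k + 5) × MinimalRepresentatives (Btilde n) (λ (i : Fin (k + 5)) → repsEven n k (toℕ i))
    classes = classes-from-index k (k + 5) (repsEven n k) index-reps cover minimal

corollary2p20 : (n : ℕ) → 4 ≤ n →
    ((k : ℕ) → n ≡ 2 * k + 1 →
      NumClasses (Btilde n) (k + 4) ×
      MinimalRepresentatives (Btilde n) (λ (i : Fin (k + 4)) → repsOdd n k (toℕ i)))
    ×
    ((k : ℕ) → n ≡ 2 * k →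
      NumClasses (Btilde n) (k + 5) ×
      MinimalRepresentatives (Btilde n) (λ (i : Fin (k + 5)) → repsEven n k (toℕ i)))
corollary2p20 0                   ()
corollary2p20 1                   (s≤s ())
corollary2p20 2                   (s≤s (s≤s ()))
corollary2p20 3                   (s≤s (s≤s (s≤s ())))
corollary2p20 (suc (suc (suc (suc r)))) _ =
    (λ k n≡2k+1 → Odd.classes k (trans n≡2k+1 (+-comm (2 * k) 1)))
  , λ { (suc (suc a)) n≡2k → Even.classes a (+-cancelˡ-≡ 4 r (2 * a) (trans n≡2k (2[a+2]≡4+2a a))) }
  where open PuzzleB̃ r using (module Odd; module Even)
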